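{- Let $r\ge5$ and $p>r$ be primes and $A,B,C$ nonzero pairwise coprime integers, none divisible by the $r$-th power of a prime. (a) If $(a,b,c)\in\mathbb Z^3$ with $abc\ne0$, $\gcd(a,b,c)=1$ and $Aa^p+Bb^p=Cc^r$, set $s_0=Aa^p/(Cc^r)$ and $\delta_{\mathbb Q}=Cc$. (b) If $(a,b,c)\in\mathbb Z^3$ with $abc\ne0$, $\gcd(a,b,c)=1$ and $Aa^r+Bb^r=Cc^p$, let $z_0\in\overline{\mathbb Q}$ be a square root of $-ABab$ and set $s_0=\frac12+\frac{(AB)^{(r-1)/2}(Aa^r-Bb^r)}{4z_0^r}$ and $\delta_{\mathbb Q}=z_0$. In either case, for every rational prime $q$, writing $\nu_q=v_q(s_0(s_0-1))$: (H1) if $\nu_q\ge0$ then $v_q(\delta_{\mathbb Q})=0$ and $v_q(2-4s_0)\in\mathbb Z$; (H2) if $q\ge3$, $\nu_q\le0$ and $\nu_q\equiv0\pmod r$, then $v_q(\delta_{\mathbb Q}^{2r}s_0(s_0-1))=0$; (H3) if $q=2$ and $\nu_2\le0$, then $\nu_2\notin\{ -3,-1\}$.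
   Context: For each prime $q$, an embedding $\overline{\mathbb Q}\hookrightarrow\overline{\mathbb Q}_q$ is fixed and $v_q$ denotes the valuation on $\overline{\mathbb Q}_q$ with $v_q(q)=1$. In case (a), $s_0(s_0-1)=-Aa^pBb^p/(Cc^r)^2$; in case (b), $s_0(s_0-1)=-(Cc^p)^2/(16Aa^rBb^r)$. -}

module Defs where

open import Data.Nat as ℕ using (ℕ; zero; suc)
open import Data.Nat.Divisibility using (_∣?_; _∣_)
open import Data.Integer as ℤ using (ℤ; +_)
open import Data.Rational as ℚ using (ℚ; ↥_; ↧ₙ_; 0ℚ; 1ℚ; ½)
open import Data.Product using (Σ; _×_)
open import Data.Sum using (_⊎_)
open import Relation.Nullary using (¬_; yes; no)
open import Relation.Binary.PropositionalEquality using (_≡_; _≢_)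

ι : ℤ → ℚ
ι z = z ℚ./ 1

infixr 8 _^ℚ_
_^ℚ_ : ℚ → ℕ → ℚ
x ^ℚ zero  = 1ℚ
x ^ℚ suc n = x ℚ.* (x ^ℚ n)

-- q-adic valuation.
-- vℕ q n = exponent of q in n (meaningful for q ≥ 2 and n ≥ 1; the
-- fuel n suffices since q^k ∣ n, n ≥ 1 forces k < n).
vℕ-go : ℕ → ℕ → ℕ → ℕ
vℕ-go q zero    m = 0
vℕ-go q (suc f) m with q ∣? m
... | yes d = suc (vℕ-go q f (_∣_.quotient d))
... | no _  = 0

vℕ : ℕ → ℕ → ℕ
vℕ q n = vℕ-go q n n

vℚ : ℕ → ℚ → ℤ
vℚ q x = (+ vℕ q ℤ.∣ ↥ x ∣) ℤ.- (+ vℕ q (↧ₙ x))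

-- ValQ q x k : x ≠ 0 and v_q(x) = k  (v_q(0) = ∞ is never a rational k)
ValQ : ℕ → ℚ → ℚ → Set
ValQ q x k = (x ≢ 0ℚ) × (k ≡ ι (vℚ q x))

IsInt : ℚ → Set
IsInt k = Σ ℤ λ m → k ≡ ι m

-- The quadratic algebra ℚ(z₀) = ℚ[X]/(X² - d), element u + w·z₀, where
-- z₀ is a square root of d.
record QZ : Set where
  constructor _+_z₀
  field
    re : ℚ
    im : ℚ
open QZ public

module Quad (d : ℚ) where
  fromℚ : ℚ → QZ
  fromℚ u = u + 0ℚ z₀

  z₀ : QZ
  z₀ = 0ℚ + 1ℚ z₀

  _⊕_ : QZ → QZ → QZ
  (u + w z₀) ⊕ (u' + w' z₀) = (u ℚ.+ u') + (w ℚ.+ w') z₀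

  _⊖_ : QZ → QZ → QZ
  (u + w z₀) ⊖ (u' + w' z₀) = (u ℚ.- u') + (w ℚ.- w') z₀

  _⊗_ : QZ → QZ → QZ
  (u + w z₀) ⊗ (u' + w' z₀) =
    (u ℚ.* u' ℚ.+ d ℚ.* (w ℚ.* w')) + (u ℚ.* w' ℚ.+ w ℚ.* u') z₀

  _^Q_ : QZ → ℕ → QZ
  x ^Q zero  = fromℚ 1ℚ
  x ^Q suc n = x ⊗ (x ^Q n)

  -- Valuation v_q (normalised v_q(q) = 1) of the image in \bar{ℚ}_q of
  -- an element of ℚ(z₀).  It is only defined (independently of the
  -- embedding / of the choice of square root) on nonzero elements that
  -- are rational (u ≠ 0, w = 0: value v_q(u)) or rational multiples of
  -- z₀ (u = 0, w ≠ 0: value v_q(w) + v_q(d)/2, since z₀² = d).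
  -- These are the only kinds of elements to which it is applied.
  Val : ℕ → QZ → ℚ → Set
  Val q x k =
    (im x ≡ 0ℚ × re x ≢ 0ℚ × k ≡ ι (vℚ q (re x))) ⊎
    (re x ≡ 0ℚ × im x ≢ 0ℚ × k ≡ ι (vℚ q (im x)) ℚ.+ ½ ℚ.* ι (vℚ q d))

-- With ν = v_q(s₀(s₀ − 1)), everything reduces to valuations of integers.  In case (a),
-- s₀(s₀ − 1)(C c^r)² = −(A a^p)(B b^p).  In case (b), write r = 2k + 1 and d = −ABab, so that
-- z₀^r = d^k z₀; comparing coordinates in ℚ(z₀) gives s₀ = ½ + w z₀ with w rational, hence
-- s₀(s₀ − 1) = d w² − ¼ is rational and 16 d^r s₀(s₀ − 1) = ((AB)^k C c^p)².
-- The arithmetic input is that no prime q divides both C c and ABab: otherwise q divides all three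
-- terms of the equation, hence (A, B, C being pairwise coprime) two of a, b, c, but not the third
-- as gcd(a, b, c) = 1; then q^r divides the third term but not its base, hence its coefficient.
-- So in ν either v_q(C c) = 0 or v_q(ABab) = 0, and each claim becomes an inequality, parity or
-- divisibility statement between natural numbers, using v_q(A), v_q(B), v_q(C) < r and that r is
-- an odd prime.

module Submission where

open import Defs
open import Data.Nat as ℕ using (ℕ; zero; suc; z≤n; s≤s; NonZero)
import Data.Nat.Properties as ℕP
open import Data.Nat.Divisibility as ℕD using (divides; _∣_)
open import Data.Nat.Coprimality using (Coprime)
open import Data.Nat.Induction using (<-rec)
open import Data.Nat.Primality using (Prime; composite; euclidsLemma; prime⇒nonZero; prime⇒nonTrivial)
import Data.Nat.DivMod as DivMod
open import Data.Integer as ℤ using (ℤ; +_)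
import Data.Integer.Properties as ℤP
import Data.Integer.Divisibility as ℤD
import Data.Integer.Divisibility.Signed as ℤDS
open import Data.Nat.Tactic.RingSolver using () renaming (solve-∀ to ℕ-solve-∀)
open import Data.Integer.Tactic.RingSolver using () renaming (solve-∀ to ℤ-solve-∀)
open import Data.Rational as ℚ using (ℚ; 0ℚ; 1ℚ; ½; ↥_; ↧_; ↧ₙ_; mkℚ)
import Data.Rational.Properties as ℚP
import Data.Rational.Unnormalised as ℚᵘ
import Data.Rational.Unnormalised.Properties as ℚᵘP
open import Relation.Nullary.Decidable.Core using (dec⇒maybe)
import Tactic.RingSolver as RingSolver
import Tactic.RingSolver.Core.AlmostCommutativeRing as ACR
open import Data.Product using (Σ; ∃₂; _×_; _,_; proj₁; proj₂)
open import Data.Sum as Sum using (_⊎_; inj₁; inj₂; [_,_]′)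
open import Data.Empty using (⊥; ⊥-elim)
open import Function using (_∘_; id)
open import Relation.Nullary using (¬_; yes; no)
open import Relation.Binary.PropositionalEquality

ℚ-ring : ACR.AlmostCommutativeRing _ _
ℚ-ring = ACR.fromCommutativeRing ℚP.+-*-commutativeRing (λ x → dec⇒maybe (0ℚ ℚP.≟ x))

toℚᵘ-ι : ∀ z → ℚ.toℚᵘ (ι z) ℚᵘ.≃ ℚᵘ.mkℚᵘ z 0
toℚᵘ-ι z = ℚP.toℚᵘ-fromℚᵘ (ℚᵘ.mkℚᵘ z 0)

ι-injective : ∀ {m n} → ι m ≡ ι n → m ≡ n
ι-injective {m} {n} eq with ℚᵘP.≃-trans (ℚᵘP.≃-sym (toℚᵘ-ι m)) (ℚᵘP.≃-trans (ℚP.toℚᵘ-cong eq) (toℚᵘ-ι n))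
... | ℚᵘ.*≡* m*1≡n*1 = ℤP.*-cancelʳ-≡ m n (+ 1) m*1≡n*1

ι-cancel-≤ : ∀ {m n} → ι m ℚ.≤ ι n → m ℤ.≤ n
ι-cancel-≤ {m} {n} ιm≤ιn
  with ℚᵘP.≤-respʳ-≃ (toℚᵘ-ι n) (ℚᵘP.≤-respˡ-≃ (toℚᵘ-ι m) (ℚP.toℚᵘ-mono-≤ ιm≤ιn))
... | ℚᵘ.*≤* m*1≤n*1 = subst₂ ℤ._≤_ (ℤP.*-identityʳ m) (ℤP.*-identityʳ n) m*1≤n*1

ι-homo-* : ∀ m n → ι (m ℤ.* n) ≡ ι m ℚ.* ι n
ι-homo-* m n = ℚP.toℚᵘ-injective (begin
  ℚ.toℚᵘ (ι (m ℤ.* n))                   ≈⟨ toℚᵘ-ι (m ℤ.* n) ⟩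
  ℚᵘ.mkℚᵘ m 0 ℚᵘ.* ℚᵘ.mkℚᵘ n 0            ≈⟨ ℚᵘP.*-cong (toℚᵘ-ι m) (toℚᵘ-ι n) ⟨
  ℚ.toℚᵘ (ι m) ℚᵘ.* ℚ.toℚᵘ (ι n)         ≈⟨ ℚP.toℚᵘ-homo-* (ι m) (ι n) ⟨
  ℚ.toℚᵘ (ι m ℚ.* ι n)                   ∎)
  where open ℚᵘP.≃-Reasoning

ι-homo-+ : ∀ m n → ι (m ℤ.+ n) ≡ ι m ℚ.+ ι n
ι-homo-+ m n = ℚP.toℚᵘ-injective (begin
  ℚ.toℚᵘ (ι (m ℤ.+ n))                   ≈⟨ toℚᵘ-ι (m ℤ.+ n) ⟩
  ℚᵘ.mkℚᵘ (m ℤ.+ n) 0                     ≈⟨ ℚᵘ.*≡* (sum-over-1 m n) ⟩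
  ℚᵘ.mkℚᵘ m 0 ℚᵘ.+ ℚᵘ.mkℚᵘ n 0            ≈⟨ ℚᵘP.+-cong (toℚᵘ-ι m) (toℚᵘ-ι n) ⟨
  ℚ.toℚᵘ (ι m) ℚᵘ.+ ℚ.toℚᵘ (ι n)         ≈⟨ ℚP.toℚᵘ-homo-+ (ι m) (ι n) ⟨
  ℚ.toℚᵘ (ι m ℚ.+ ι n)                   ∎)
  where
  open ℚᵘP.≃-Reasoning
  sum-over-1 : ∀ m n → (m ℤ.+ n) ℤ.* + 1 ≡ (m ℤ.* + 1 ℤ.+ n ℤ.* + 1) ℤ.* + 1
  sum-over-1 = ℤ-solve-∀

ι-homo‿- : ∀ z → ι (ℤ.- z) ≡ ℚ.- ι z
ι-homo‿- z = ℚP.toℚᵘ-injective (begin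
  ℚ.toℚᵘ (ι (ℤ.- z))                     ≈⟨ toℚᵘ-ι (ℤ.- z) ⟩
  ℚᵘ.mkℚᵘ (ℤ.- z) 0                       ≈⟨ ℚᵘP.-‿cong (toℚᵘ-ι z) ⟨
  ℚᵘ.- ℚ.toℚᵘ (ι z)                      ≈⟨ ℚP.toℚᵘ-homo‿- (ι z) ⟨
  ℚ.toℚᵘ (ℚ.- ι z)                       ∎)
  where open ℚᵘP.≃-Reasoning

ι-homo-^ : ∀ z n → ι (z ℤ.^ n) ≡ ι z ^ℚ n
ι-homo-^ z zero    = refl
ι-homo-^ z (suc n) = trans (ι-homo-* z (z ℤ.^ n)) (cong (ι z ℚ.*_) (ι-homo-^ z n))

ι≢0 : ∀ {z} → z ≢ + 0 → ι z ≢ 0ℚ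
ι≢0 z≢0 ιz≡0 = z≢0 (ι-injective ιz≡0)

*ι≡ι⇒↥*≡*↧ : ∀ x D N → x ℚ.* ι D ≡ ι N → ↥ x ℤ.* D ≡ N ℤ.* ↧ x
*ι≡ι⇒↥*≡*↧ x@(mkℚ _ _ _) D N eq
  with ℚᵘP.≃-trans (ℚᵘP.*-congˡ {ℚ.toℚᵘ x} (ℚᵘP.≃-sym (toℚᵘ-ι D)))
         (ℚᵘP.≃-trans (ℚᵘP.≃-sym (ℚP.toℚᵘ-homo-* x (ι D))) (ℚᵘP.≃-trans (ℚP.toℚᵘ-cong eq) (toℚᵘ-ι N)))
... | ℚᵘ.*≡* eq′ = trans (sym (ℤP.*-identityʳ _)) (trans eq′ (cong (N ℤ.*_) (ℤP.*-identityʳ (↧ x))))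

*ι↧≡ι↥ : ∀ x → x ℚ.* ι (↧ x) ≡ ι (↥ x)
*ι↧≡ι↥ x@(mkℚ _ _ _) = ℚP.toℚᵘ-injective (begin
  ℚ.toℚᵘ (x ℚ.* ι (↧ x))                 ≈⟨ ℚP.toℚᵘ-homo-* x (ι (↧ x)) ⟩
  ℚ.toℚᵘ x ℚᵘ.* ℚ.toℚᵘ (ι (↧ x))         ≈⟨ ℚᵘP.*-congˡ {ℚ.toℚᵘ x} (toℚᵘ-ι (↧ x)) ⟩
  ℚ.toℚᵘ x ℚᵘ.* ℚᵘ.mkℚᵘ (↧ x) 0          ≈⟨ ℚᵘ.*≡* (reassoc (↥ x) (↧ x)) ⟩
  ℚᵘ.mkℚᵘ (↥ x) 0                         ≈⟨ toℚᵘ-ι (↥ x) ⟨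
  ℚ.toℚᵘ (ι (↥ x))                       ∎)
  where
  open ℚᵘP.≃-Reasoning
  reassoc : ∀ a b → a ℤ.* b ℤ.* + 1 ≡ a ℤ.* (b ℤ.* + 1)
  reassoc = ℤ-solve-∀

0≤ι[m-n]⇒n≤m : ∀ {m n} → 0ℚ ℚ.≤ ι (+ m ℤ.- + n) → n ℕ.≤ m
0≤ι[m-n]⇒n≤m = ℤP.drop‿+≤+ ∘ ℤP.0≤i-j⇒j≤i ∘ ι-cancel-≤

ι[m-n]≤0⇒m≤n : ∀ {m n} → ι (+ m ℤ.- + n) ℚ.≤ 0ℚ → m ℕ.≤ n
ι[m-n]≤0⇒m≤n = ℤP.drop‿+≤+ ∘ ℤP.i-j≤0⇒i≤j ∘ ι-cancel-≤

p*q≢0 : ∀ {p q} → p ≢ 0ℚ → q ≢ 0ℚ → p ℚ.* q ≢ 0ℚ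
p*q≢0 {p} {q} p≢0 q≢0 pq≡0 = q≢0 (begin
  q                      ≡⟨ ℚP.*-identityˡ q ⟨
  1ℚ ℚ.* q               ≡⟨ cong (ℚ._* q) (ℚP.*-inverseˡ p) ⟨
  (ℚ.1/ p ℚ.* p) ℚ.* q   ≡⟨ ℚP.*-assoc (ℚ.1/ p) p q ⟩
  ℚ.1/ p ℚ.* (p ℚ.* q)   ≡⟨ cong (ℚ.1/ p ℚ.*_) pq≡0 ⟩
  ℚ.1/ p ℚ.* 0ℚ          ≡⟨ ℚP.*-zeroʳ (ℚ.1/ p) ⟩
  0ℚ                     ∎)
  where
  open ≡-Reasoning
  instance _ = ℚ.≢-nonZero p≢0

*-cancelʳ-≡ : ∀ {p q r} → r ≢ 0ℚ → p ℚ.* r ≡ q ℚ.* r → p ≡ q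
*-cancelʳ-≡ {p} {q} {r} r≢0 eq = begin
  p                       ≡⟨ ℚP.*-identityʳ p ⟨
  p ℚ.* 1ℚ                ≡⟨ cong (p ℚ.*_) (ℚP.*-inverseʳ r) ⟨
  p ℚ.* (r ℚ.* ℚ.1/ r)    ≡⟨ ℚP.*-assoc p r (ℚ.1/ r) ⟨
  (p ℚ.* r) ℚ.* ℚ.1/ r    ≡⟨ cong (ℚ._* ℚ.1/ r) eq ⟩
  (q ℚ.* r) ℚ.* ℚ.1/ r    ≡⟨ ℚP.*-assoc q r (ℚ.1/ r) ⟩
  q ℚ.* (r ℚ.* ℚ.1/ r)    ≡⟨ cong (q ℚ.*_) (ℚP.*-inverseʳ r) ⟩
  q ℚ.* 1ℚ                ≡⟨ ℚP.*-identityʳ q ⟩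
  q                       ∎
  where
  open ≡-Reasoning
  instance _ = ℚ.≢-nonZero r≢0

i*j≢0 : ∀ {i j} → i ≢ + 0 → j ≢ + 0 → i ℤ.* j ≢ + 0
i*j≢0 {i} i≢0 j≢0 ij≡0 = [ i≢0 , j≢0 ]′ (ℤP.i*j≡0⇒i≡0∨j≡0 i ij≡0)

-i≢0 : ∀ {i} → i ≢ + 0 → ℤ.- i ≢ + 0
-i≢0 {i} i≢0 -i≡0 = i≢0 (trans (sym (ℤP.neg-involutive i)) (cong ℤ.-_ -i≡0))

i^n≢0 : ∀ {i} n → i ≢ + 0 → i ℤ.^ n ≢ + 0
i^n≢0 {i} n i≢0 iⁿ≡0 = i≢0 (ℤP.i^n≡0⇒i≡0 i n iⁿ≡0)

i*j≢0⇒i≢0 : ∀ {i j} → i ℤ.* j ≢ + 0 → i ≢ + 0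
i*j≢0⇒i≢0 {j = j} ij≢0 i≡0 = ij≢0 (trans (cong (ℤ._* j) i≡0) (ℤP.*-zeroˡ j))

i*j≢0⇒j≢0 : ∀ {i j} → i ℤ.* j ≢ + 0 → j ≢ + 0
i*j≢0⇒j≢0 {i} ij≢0 j≡0 = ij≢0 (trans (cong (i ℤ.*_) j≡0) (ℤP.*-zeroʳ i))

∣i^n∣≡∣i∣^n : ∀ i n → ℤ.∣ i ℤ.^ n ∣ ≡ ℤ.∣ i ∣ ℕ.^ n
∣i^n∣≡∣i∣^n i zero    = refl
∣i^n∣≡∣i∣^n i (suc n) = trans (ℤP.abs-* i (i ℤ.^ n)) (cong (ℤ.∣ i ∣ ℕ.*_) (∣i^n∣≡∣i∣^n i n))

∣K*kⁿ∣ : ∀ K k n → ℤ.∣ K ℤ.* k ℤ.^ n ∣ ≡ ℤ.∣ K ∣ ℕ.* ℤ.∣ k ∣ ℕ.^ n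
∣K*kⁿ∣ K k n = trans (ℤP.abs-* K (k ℤ.^ n)) (cong (ℤ.∣ K ∣ ℕ.*_) (∣i^n∣≡∣i∣^n k n))

^-distribʳ-* : ∀ i j n → (i ℤ.* j) ℤ.^ n ≡ i ℤ.^ n ℤ.* j ℤ.^ n
^-distribʳ-* i j zero    = refl
^-distribʳ-* i j (suc n) = trans (cong (i ℤ.* j ℤ.*_) (^-distribʳ-* i j n)) (interchange i j (i ℤ.^ n) (j ℤ.^ n))
  where
  interchange : ∀ a b c d → a ℤ.* b ℤ.* (c ℤ.* d) ≡ a ℤ.* c ℤ.* (b ℤ.* d)
  interchange = ℤ-solve-∀

i^[2k+1] : ∀ i k → i ℤ.^ suc (2 ℕ.* k) ≡ i ℤ.* (i ℤ.^ k ℤ.* i ℤ.^ k)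
i^[2k+1] i k = cong (i ℤ.*_)
  (trans (ℤP.^-distribˡ-+-* i k (k ℕ.+ 0)) (cong (λ n → i ℤ.^ k ℤ.* i ℤ.^ n) (ℕP.+-identityʳ k)))

a+d≡c+b⇒a-b≡c-d : ∀ {a b c d} → a ℕ.+ d ≡ c ℕ.+ b → + a ℤ.- + b ≡ + c ℤ.- + d
a+d≡c+b⇒a-b≡c-d {a} {b} {c} {d} eq = begin
  + a ℤ.- + b                      ≡⟨ shift (+ a) (+ b) (+ d) ⟩
  (+ a ℤ.+ + d) ℤ.- (+ b ℤ.+ + d)  ≡⟨ cong (ℤ._- (+ b ℤ.+ + d)) a+d≡c+b ⟩
  (+ c ℤ.+ + b) ℤ.- (+ b ℤ.+ + d)  ≡⟨ unshift (+ c) (+ b) (+ d) ⟩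
  + c ℤ.- + d                      ∎
  where
  open ≡-Reasoning
  shift : ∀ x y z → x ℤ.- y ≡ (x ℤ.+ z) ℤ.- (y ℤ.+ z)
  shift = ℤ-solve-∀
  unshift : ∀ x y z → (x ℤ.+ y) ℤ.- (y ℤ.+ z) ≡ x ℤ.- z
  unshift = ℤ-solve-∀
  a+d≡c+b : + a ℤ.+ + d ≡ + c ℤ.+ + b
  a+d≡c+b = trans (sym (ℤP.pos-+ a d)) (trans (cong +_ eq) (ℤP.pos-+ c b))

m-n≡-k⇒n≡m+k : ∀ {m n k} → + m ℤ.- + n ≡ ℤ.- + k → n ≡ m ℕ.+ k
m-n≡-k⇒n≡m+k {m} {n} {k} eq = ℤP.+-injective (begin
  + n                       ≡⟨ solve₁ (+ m) (+ n) ⟩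
  + m ℤ.- (+ m ℤ.- + n)     ≡⟨ cong (ℤ._-_ (+ m)) eq ⟩
  + m ℤ.- ℤ.- + k           ≡⟨ solve₂ (+ m) (+ k) ⟩
  + m ℤ.+ + k               ≡⟨ ℤP.pos-+ m k ⟨
  + (m ℕ.+ k)               ∎)
  where
  open ≡-Reasoning
  solve₁ : ∀ i j → j ≡ i ℤ.- (i ℤ.- j)
  solve₁ = ℤ-solve-∀
  solve₂ : ∀ i j → i ℤ.- ℤ.- j ≡ i ℤ.+ j
  solve₂ = ℤ-solve-∀

t+m≡n⇒t+[m-n]≡0 : ∀ {t m n} → t ℕ.+ m ≡ n → + t ℤ.+ (+ m ℤ.- + n) ≡ + 0
t+m≡n⇒t+[m-n]≡0 {t} {m} refl = trans (cong (λ i → + t ℤ.+ (+ m ℤ.- i)) (ℤP.pos-+ t m)) (cancel (+ t) (+ m))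
  where
  cancel : ∀ i j → i ℤ.+ (j ℤ.- (i ℤ.+ j)) ≡ + 0
  cancel = ℤ-solve-∀

r∣m-n∧r∣m⇒r∣n : ∀ {m n r} (i : ℤ) → + m ℤ.- + n ≡ i ℤ.* + r → r ∣ m → r ∣ n
r∣m-n∧r∣m⇒r∣n {m} {n} {r} i eq r∣m = ℤDS.∣⇒∣ᵤ {+ r} {+ n}
  (subst (+ r ℤDS.∣_) (cancel (+ m) (+ n)) (ℤDS.∣m∣n⇒∣m-n (ℤDS.∣ᵤ⇒∣ {+ r} {+ m} r∣m) (ℤDS.divides i eq)))
  where
  cancel : ∀ i j → i ℤ.- (i ℤ.- j) ≡ j
  cancel = ℤ-solve-∀

r∣m-n∧r∣n⇒r∣m : ∀ {m n r} (i : ℤ) → + m ℤ.- + n ≡ i ℤ.* + r → r ∣ n → r ∣ m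
r∣m-n∧r∣n⇒r∣m {m} {n} {r} i eq r∣n = ℤDS.∣⇒∣ᵤ {+ r} {+ m}
  (subst (+ r ℤDS.∣_) (cancel (+ m) (+ n)) (ℤDS.∣m∣n⇒∣m+n (ℤDS.divides i eq) (ℤDS.∣ᵤ⇒∣ {+ r} {+ n} r∣n)))
  where
  cancel : ∀ i j → i ℤ.- j ℤ.+ j ≡ i
  cancel = ℤ-solve-∀

m*n≢0 : ∀ {m n} → m ≢ 0 → n ≢ 0 → m ℕ.* n ≢ 0
m*n≢0 {m} m≢0 n≢0 mn≡0 = [ m≢0 , n≢0 ]′ (ℕP.m*n≡0⇒m≡0∨n≡0 m mn≡0)

j≤k⇒m^j∣m^k : ∀ m {j k} → j ℕ.≤ k → m ℕ.^ j ∣ m ℕ.^ k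
j≤k⇒m^j∣m^k m {j} {k} j≤k = divides (m ℕ.^ (k ℕ.∸ j)) (begin
  m ℕ.^ k                     ≡⟨ cong (m ℕ.^_) (ℕP.m∸n+n≡m j≤k) ⟨
  m ℕ.^ (k ℕ.∸ j ℕ.+ j)       ≡⟨ ℕP.^-distribˡ-+-* m (k ℕ.∸ j) j ⟩
  m ℕ.^ (k ℕ.∸ j) ℕ.* m ℕ.^ j ∎)
  where open ≡-Reasoning

m∣n⇒m^k∣n^k : ∀ {m n} k → m ∣ n → m ℕ.^ k ∣ n ℕ.^ k
m∣n⇒m^k∣n^k zero    m∣n = ℕD.∣-refl
m∣n⇒m^k∣n^k (suc k) m∣n = ℕD.*-pres-∣ m∣n (m∣n⇒m^k∣n^k k m∣n)

d∣n⇒d^j∣m*n^k : ∀ {d n j k} m → d ∣ n → j ℕ.≤ k → d ℕ.^ j ∣ m ℕ.* n ℕ.^ k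
d∣n⇒d^j∣m*n^k {d} {k = k} m d∣n j≤k = ℕD.∣n⇒∣m*n m (ℕD.∣-trans (j≤k⇒m^j∣m^k d j≤k) (m∣n⇒m^k∣n^k k d∣n))

d∣n⇒d∣m*n^k : ∀ {d n k} m → d ∣ n → 1 ℕ.≤ k → d ∣ m ℕ.* n ℕ.^ k
d∣n⇒d∣m*n^k {n = n} {k = suc k} m d∣n _ = ℕD.∣n⇒∣m*n m (ℕD.∣m⇒∣m*n (n ℕ.^ k) d∣n)

prime∣m*n^k⇒∣m⊎∣n : ∀ {p m n} k → Prime p → p ∣ m ℕ.* n ℕ.^ k → p ∣ m ⊎ p ∣ n
prime∣m*n^k⇒∣m⊎∣n {p} {m} zero    p-prime p∣m*1 = inj₁ (subst (p ∣_) (ℕP.*-identityʳ m) p∣m*1)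
prime∣m*n^k⇒∣m⊎∣n {p} {m} {n} (suc k) p-prime p∣mnⁿᵏ with euclidsLemma m (n ℕ.* n ℕ.^ k) p-prime p∣mnⁿᵏ
... | inj₁ p∣m  = inj₁ p∣m
... | inj₂ p∣nnᵏ with euclidsLemma n (n ℕ.^ k) p-prime p∣nnᵏ
...   | inj₁ p∣n  = inj₂ p∣n
...   | inj₂ p∣nᵏ = prime∣m*n^k⇒∣m⊎∣n k p-prime (ℕD.∣n⇒∣m*n m p∣nᵏ)

prime∣m∣n⇒¬coprime : ∀ {p m n} → Prime p → p ∣ m → p ∣ n → ¬ Coprime m n
prime∣m∣n⇒¬coprime p-prime p∣m p∣n coprime =
  ℕ.nonTrivial⇒≢1 {{prime⇒nonTrivial p-prime}} (coprime (p∣m , p∣n))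

prime∣m*n⇒n≡0 : ∀ {p m n} → Prime p → 0 ℕ.< m → m ℕ.< p → n ℕ.< p → p ∣ m ℕ.* n → n ≡ 0
prime∣m*n⇒n≡0 {p} {m} {n} p-prime 0<m m<p n<p p∣mn with euclidsLemma m n p-prime p∣mn
... | inj₁ p∣m = ⊥-elim (ℕP.<⇒≱ m<p (ℕD.∣⇒≤ {{ℕ.>-nonZero 0<m}} p∣m))
... | inj₂ p∣n with n
...   | zero  = refl
...   | suc _ = ⊥-elim (ℕP.<⇒≱ n<p (ℕD.∣⇒≤ p∣n))

prime≥3⇒odd : ∀ {r} → Prime r → 3 ℕ.≤ r → r ≡ suc (2 ℕ.* ((r ℕ.∸ 1) ℕ./ 2))
prime≥3⇒odd {r} r-prime 3≤r with r ℕ.% 2 in r%2≡ | DivMod.m%n<n r 2 | DivMod.m≡m%n+[m/n]*n r 2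
... | zero          | _                 | _ =
  ⊥-elim (Prime.notComposite r-prime (composite {2} 3≤r (ℕD.m%n≡0⇒n∣m r 2 r%2≡)))
... | suc (suc _)   | s≤s (s≤s ())      | _
... | suc zero      | _                 | r≡1+[r/2]*2 =
  trans r≡1+[r/2]*2 (cong suc (trans (ℕP.*-comm (r ℕ./ 2) 2) (cong (2 ℕ.*_) (sym [r-1]/2≡r/2))))
  where
  [r-1]/2≡r/2 : (r ℕ.∸ 1) ℕ./ 2 ≡ r ℕ./ 2
  [r-1]/2≡r/2 = trans (cong (λ n → (n ℕ.∸ 1) ℕ./ 2) r≡1+[r/2]*2) (DivMod.m*n/n≡m (r ℕ./ 2) 2)

-- q-adic valuations
vℤ : ℕ → ℤ → ℕ
vℤ q z = vℕ q ℤ.∣ z ∣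

vℤ-neg : ∀ q z → vℤ q (ℤ.- z) ≡ vℤ q z
vℤ-neg q z = cong (vℕ q) (ℤP.∣-i∣≡∣i∣ z)

module _ {q : ℕ} (q-prime : Prime q) where

  private instance
    q≢0 : NonZero q
    q≢0 = prime⇒nonZero q-prime
    q-nonTrivial : ℕ.NonTrivial q
    q-nonTrivial = prime⇒nonTrivial q-prime

  q∤1 : ¬ q ∣ 1
  q∤1 q∣1 = ℕ.nonTrivial⇒≢1 {q} (ℕD.∣1⇒≡1 q∣1)

  n<q^n : ∀ n → n ℕ.< q ℕ.^ n
  n<q^n zero    = s≤s z≤n
  n<q^n (suc n) = ℕP.≤-<-trans (n<q^n n) (ℕP.^-monoʳ-< q (ℕ.nonTrivial⇒n>1 q) (ℕP.n<1+n n))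

  private
    q∤⇒nonZero : ∀ {m} → ¬ q ∣ m → NonZero m
    q∤⇒nonZero {zero}  q∤0 = ⊥-elim (q∤0 (q ℕD.∣0))
    q∤⇒nonZero {suc m} _   = _

    vℕ-go-q^k*m : ∀ {m} → ¬ q ∣ m → ∀ k {f} → k ℕ.≤ f → vℕ-go q f (q ℕ.^ k ℕ.* m) ≡ k
    vℕ-go-q^k*m q∤m zero {zero} _ = refl
    vℕ-go-q^k*m {m} q∤m zero {suc f} _ with q ℕD.∣? (1 ℕ.* m)
    ... | yes q∣m = ⊥-elim (q∤m (subst (q ∣_) (ℕP.*-identityˡ m) q∣m))
    ... | no _    = refl
    vℕ-go-q^k*m {m} q∤m (suc k) {suc f} (s≤s k≤f) with q ℕD.∣? (q ℕ.^ suc k ℕ.* m)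
    ... | no q∤  = ⊥-elim (q∤ (ℕD.∣m⇒∣m*n m (ℕD.m∣m*n (q ℕ.^ k))))
    ... | yes q∣ = cong suc (trans (cong (vℕ-go q f) quotient≡) (vℕ-go-q^k*m q∤m k k≤f))
      where
      quotient≡ : ℕD.quotient q∣ ≡ q ℕ.^ k ℕ.* m
      quotient≡ = ℕP.*-cancelʳ-≡ _ _ q (trans (sym (ℕD.m∣n⇒n≡quotient*m q∣))
                    (trans (ℕP.*-assoc q (q ℕ.^ k) m) (ℕP.*-comm q (q ℕ.^ k ℕ.* m))))

  vℕ[q^k*m]≡k : ∀ {m} → ¬ q ∣ m → ∀ k → vℕ q (q ℕ.^ k ℕ.* m) ≡ k
  vℕ[q^k*m]≡k {m} q∤m k = vℕ-go-q^k*m q∤m k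
    (ℕP.<⇒≤ (ℕP.<-≤-trans (n<q^n k) (ℕP.m≤m*n (q ℕ.^ k) m {{q∤⇒nonZero q∤m}})))

  q∤⇒vℕ≡0 : ∀ {n} → ¬ q ∣ n → vℕ q n ≡ 0
  q∤⇒vℕ≡0 {n} q∤n = trans (cong (vℕ q) (sym (ℕP.*-identityˡ n))) (vℕ[q^k*m]≡k q∤n 0)

  q-adic-decomposition : ∀ n → n ≢ 0 → ∃₂ λ k m → ¬ q ∣ m × n ≡ q ℕ.^ k ℕ.* m
  q-adic-decomposition = <-rec _ decompose
    where
    decompose : ∀ n → (∀ {n′} → n′ ℕ.< n → n′ ≢ 0 → ∃₂ λ k m → ¬ q ∣ m × n′ ≡ q ℕ.^ k ℕ.* m) →
                n ≢ 0 → ∃₂ λ k m → ¬ q ∣ m × n ≡ q ℕ.^ k ℕ.* m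
    decompose n rec n≢0 with q ℕD.∣? n
    ... | no q∤n  = 0 , n , q∤n , sym (ℕP.*-identityˡ n)
    ... | yes q∣n with rec (ℕD.quotient-< q∣n {{q-nonTrivial}} {{ℕ.≢-nonZero n≢0}})
                           (λ quotient≡0 → n≢0 (trans (ℕD.m∣n⇒n≡quotient*m q∣n) (cong (ℕ._* q) quotient≡0)))
    ...   | k , m , q∤m , quotient≡ = suc k , m , q∤m , (begin
      n                            ≡⟨ ℕD.m∣n⇒n≡quotient*m q∣n ⟩
      ℕD.quotient q∣n ℕ.* q        ≡⟨ cong (ℕ._* q) quotient≡ ⟩
      q ℕ.^ k ℕ.* m ℕ.* q          ≡⟨ ℕP.*-comm (q ℕ.^ k ℕ.* m) q ⟩
      q ℕ.* (q ℕ.^ k ℕ.* m)        ≡⟨ ℕP.*-assoc q (q ℕ.^ k) m ⟨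
      q ℕ.^ suc k ℕ.* m            ∎)
      where open ≡-Reasoning

  vℕ-* : ∀ {m n} → m ≢ 0 → n ≢ 0 → vℕ q (m ℕ.* n) ≡ vℕ q m ℕ.+ vℕ q n
  vℕ-* {m} {n} m≢0 n≢0 with q-adic-decomposition m m≢0 | q-adic-decomposition n n≢0
  ... | j , m′ , q∤m′ , refl | k , n′ , q∤n′ , refl = begin
    vℕ q (q ℕ.^ j ℕ.* m′ ℕ.* (q ℕ.^ k ℕ.* n′))       ≡⟨ cong (vℕ q) (regroup (q ℕ.^ j) m′ (q ℕ.^ k) n′) ⟩
    vℕ q (q ℕ.^ j ℕ.* q ℕ.^ k ℕ.* (m′ ℕ.* n′))       ≡⟨ cong (λ t → vℕ q (t ℕ.* (m′ ℕ.* n′))) (ℕP.^-distribˡ-+-* q j k) ⟨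
    vℕ q (q ℕ.^ (j ℕ.+ k) ℕ.* (m′ ℕ.* n′))           ≡⟨ vℕ[q^k*m]≡k q∤m′n′ (j ℕ.+ k) ⟩
    j ℕ.+ k                                          ≡⟨ cong₂ ℕ._+_ (vℕ[q^k*m]≡k q∤m′ j) (vℕ[q^k*m]≡k q∤n′ k) ⟨
    vℕ q (q ℕ.^ j ℕ.* m′) ℕ.+ vℕ q (q ℕ.^ k ℕ.* n′)  ∎
    where
    open ≡-Reasoning
    regroup : ∀ a b c d → a ℕ.* b ℕ.* (c ℕ.* d) ≡ a ℕ.* c ℕ.* (b ℕ.* d)
    regroup = ℕ-solve-∀
    q∤m′n′ : ¬ q ∣ m′ ℕ.* n′
    q∤m′n′ q∣m′n′ with euclidsLemma m′ n′ q-prime q∣m′n′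
    ... | inj₁ q∣m′ = q∤m′ q∣m′
    ... | inj₂ q∣n′ = q∤n′ q∣n′

  vℕ-^ : ∀ {n} e → n ≢ 0 → vℕ q (n ℕ.^ e) ≡ e ℕ.* vℕ q n
  vℕ-^ zero        n≢0 = q∤⇒vℕ≡0 q∤1
  vℕ-^ {n} (suc e) n≢0 = trans (vℕ-* n≢0 (n≢0 ∘ ℕP.m^n≡0⇒m≡0 n e)) (cong (vℕ q n ℕ.+_) (vℕ-^ e n≢0))

  ≤vℕ⇒q^j∣ : ∀ {n j} → n ≢ 0 → j ℕ.≤ vℕ q n → q ℕ.^ j ∣ n
  ≤vℕ⇒q^j∣ {n} {j} n≢0 j≤v with q-adic-decomposition n n≢0
  ... | k , m , q∤m , refl =
    ℕD.∣-trans (j≤k⇒m^j∣m^k q (subst (j ℕ.≤_) (vℕ[q^k*m]≡k q∤m k) j≤v)) (ℕD.m∣m*n m)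

  q^j∣⇒≤vℕ : ∀ {n j} → n ≢ 0 → q ℕ.^ j ∣ n → j ℕ.≤ vℕ q n
  q^j∣⇒≤vℕ {n} {j} n≢0 q^j∣n with q-adic-decomposition n n≢0
  ... | k , m , q∤m , refl rewrite vℕ[q^k*m]≡k q∤m k with j ℕ.≤? k
  ...   | yes j≤k = j≤k
  ...   | no j≰k  = ⊥-elim (q∤m (ℕD.*-cancelˡ-∣ (q ℕ.^ k) {{ℕP.m^n≢0 q k}} q^k*q∣q^k*m))
    where
    q^k*q∣q^k*m : q ℕ.^ k ℕ.* q ∣ q ℕ.^ k ℕ.* m
    q^k*q∣q^k*m = subst (_∣ q ℕ.^ k ℕ.* m) (ℕP.*-comm q (q ℕ.^ k))
                    (ℕD.∣-trans (j≤k⇒m^j∣m^k q (ℕP.≰⇒> j≰k)) q^j∣n)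

  vℤ-* : ∀ {i j} → i ≢ + 0 → j ≢ + 0 → vℤ q (i ℤ.* j) ≡ vℤ q i ℕ.+ vℤ q j
  vℤ-* {i} {j} i≢0 j≢0 =
    trans (cong (vℕ q) (ℤP.abs-* i j)) (vℕ-* (i≢0 ∘ ℤP.∣i∣≡0⇒i≡0) (j≢0 ∘ ℤP.∣i∣≡0⇒i≡0))

  vℤ-^ : ∀ {i} n → i ≢ + 0 → vℤ q (i ℤ.^ n) ≡ n ℕ.* vℤ q i
  vℤ-^ {i} n i≢0 = trans (cong (vℕ q) (∣i^n∣≡∣i∣^n i n)) (vℕ-^ n (i≢0 ∘ ℤP.∣i∣≡0⇒i≡0))

  q∤⇒vℤ≡0 : ∀ z → ¬ + q ℤD.∣ z → vℤ q z ≡ 0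
  q∤⇒vℤ≡0 z = q∤⇒vℕ≡0

  q∤i,j⇒q∤i*j : ∀ {i j} → ¬ + q ℤD.∣ i → ¬ + q ℤD.∣ j → ¬ + q ℤD.∣ i ℤ.* j
  q∤i,j⇒q∤i*j {i} {j} q∤i q∤j q∣ij =
    [ q∤i , q∤j ]′ (euclidsLemma ℤ.∣ i ∣ ℤ.∣ j ∣ q-prime (subst (q ∣_) (ℤP.abs-* i j) q∣ij))

  vℤ[K*kⁿ] : ∀ {K k} n → K ≢ + 0 → k ≢ + 0 → vℤ q (K ℤ.* k ℤ.^ n) ≡ vℤ q K ℕ.+ n ℕ.* vℤ q k
  vℤ[K*kⁿ] {K} n K≢0 k≢0 = trans (vℤ-* K≢0 (i^n≢0 n k≢0)) (cong (vℤ q K ℕ.+_) (vℤ-^ n k≢0))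

  q∤K,k⇒vℤ[K*kⁿ]≡0 : ∀ {K k} n → K ≢ + 0 → k ≢ + 0 → ¬ + q ℤD.∣ K → ¬ + q ℤD.∣ k → vℤ q (K ℤ.* k ℤ.^ n) ≡ 0
  q∤K,k⇒vℤ[K*kⁿ]≡0 {K} {k} n K≢0 k≢0 q∤K q∤k = begin
    vℤ q (K ℤ.* k ℤ.^ n)          ≡⟨ vℤ[K*kⁿ] n K≢0 k≢0 ⟩
    vℤ q K ℕ.+ n ℕ.* vℤ q k      ≡⟨ cong₂ (λ u v → u ℕ.+ n ℕ.* v) (q∤⇒vℤ≡0 K q∤K) (q∤⇒vℤ≡0 k q∤k) ⟩
    0 ℕ.+ n ℕ.* 0                 ≡⟨ ℕP.*-zeroʳ n ⟩
    0                             ∎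
    where open ≡-Reasoning

  *ι≡ι⇒vℚ≡ : ∀ x {D N} → D ≢ + 0 → N ≢ + 0 → x ℚ.* ι D ≡ ι N → vℚ q x ≡ + vℤ q N ℤ.- + vℤ q D
  *ι≡ι⇒vℚ≡ x {D} {N} D≢0 N≢0 eq = a+d≡c+b⇒a-b≡c-d {vℤ q (↥ x)} {vℤ q (↧ x)} {vℤ q N} {vℤ q D} (begin
    vℤ q (↥ x) ℕ.+ vℤ q D   ≡⟨ vℤ-* ↥x≢0 D≢0 ⟨
    vℤ q (↥ x ℤ.* D)        ≡⟨ cong (vℤ q) cross ⟩
    vℤ q (N ℤ.* ↧ x)        ≡⟨ vℤ-* N≢0 (λ ()) ⟩
    vℤ q N ℕ.+ vℤ q (↧ x)   ∎)
    where
    open ≡-Reasoning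
    cross : ↥ x ℤ.* D ≡ N ℤ.* ↧ x
    cross = *ι≡ι⇒↥*≡*↧ x D N eq
    ↥x≢0 : ↥ x ≢ + 0
    ↥x≢0 ↥x≡0 = i*j≢0 N≢0 (λ ()) (trans (sym cross) (trans (cong (ℤ._* D) ↥x≡0) (ℤP.*-zeroˡ D)))

  vℚ-ι : ∀ {z} → z ≢ + 0 → vℚ q (ι z) ≡ + vℤ q z
  vℚ-ι {z} z≢0 = begin
    vℚ q (ι z)                  ≡⟨ *ι≡ι⇒vℚ≡ (ι z) {+ 1} {z} (λ ()) z≢0 (ℚP.*-identityʳ (ι z)) ⟩
    + vℤ q z ℤ.- + vℕ q 1       ≡⟨ cong (λ v → + vℤ q z ℤ.- + v) (q∤⇒vℕ≡0 q∤1) ⟩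
    + vℤ q z ℤ.+ + 0            ≡⟨ ℤP.+-identityʳ (+ vℤ q z) ⟩
    + vℤ q z                    ∎
    where open ≡-Reasoning

  vℚ-* : ∀ {x y} → x ≢ 0ℚ → y ≢ 0ℚ → vℚ q (x ℚ.* y) ≡ vℚ q x ℤ.+ vℚ q y
  vℚ-* {x} {y} x≢0 y≢0 = begin
    vℚ q (x ℚ.* y)
      ≡⟨ *ι≡ι⇒vℚ≡ (x ℚ.* y) ↧x↧y≢0 (i*j≢0 ↥x≢0 ↥y≢0) clear ⟩
    + vℤ q (↥ x ℤ.* ↥ y) ℤ.- + vℤ q (↧ x ℤ.* ↧ y)
      ≡⟨ cong₂ (λ a b → + a ℤ.- + b) (vℤ-* ↥x≢0 ↥y≢0) (vℤ-* {↧ x} {↧ y} (λ ()) (λ ())) ⟩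
    + (nx ℕ.+ ny) ℤ.- + (dx ℕ.+ dy)
      ≡⟨ cong₂ ℤ._-_ (ℤP.pos-+ nx ny) (ℤP.pos-+ dx dy) ⟩
    (+ nx ℤ.+ + ny) ℤ.- (+ dx ℤ.+ + dy)
      ≡⟨ regroup (+ nx) (+ ny) (+ dx) (+ dy) ⟩
    vℚ q x ℤ.+ vℚ q y ∎
    where
    open ≡-Reasoning
    nx = vℤ q (↥ x)
    ny = vℤ q (↥ y)
    dx = vℤ q (↧ x)
    dy = vℤ q (↧ y)
    ↥x≢0 : ↥ x ≢ + 0
    ↥x≢0 = x≢0 ∘ ℚP.↥p≡0⇒p≡0 x
    ↥y≢0 : ↥ y ≢ + 0
    ↥y≢0 = y≢0 ∘ ℚP.↥p≡0⇒p≡0 y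
    ↧x↧y≢0 : ↧ x ℤ.* ↧ y ≢ + 0
    ↧x↧y≢0 = i*j≢0 {↧ x} {↧ y} (λ ()) (λ ())
    regroup : ∀ a b c d → (a ℤ.+ b) ℤ.- (c ℤ.+ d) ≡ (a ℤ.- c) ℤ.+ (b ℤ.- d)
    regroup = ℤ-solve-∀
    swap : ∀ a b c d → (a ℚ.* b) ℚ.* (c ℚ.* d) ≡ (a ℚ.* c) ℚ.* (b ℚ.* d)
    swap = RingSolver.solve-∀ ℚ-ring
    clear : (x ℚ.* y) ℚ.* ι (↧ x ℤ.* ↧ y) ≡ ι (↥ x ℤ.* ↥ y)
    clear = begin
      (x ℚ.* y) ℚ.* ι (↧ x ℤ.* ↧ y)            ≡⟨ cong ((x ℚ.* y) ℚ.*_) (ι-homo-* (↧ x) (↧ y)) ⟩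
      (x ℚ.* y) ℚ.* (ι (↧ x) ℚ.* ι (↧ y))      ≡⟨ swap x y (ι (↧ x)) (ι (↧ y)) ⟩
      (x ℚ.* ι (↧ x)) ℚ.* (y ℚ.* ι (↧ y))      ≡⟨ cong₂ ℚ._*_ (*ι↧≡ι↥ x) (*ι↧≡ι↥ y) ⟩
      ι (↥ x) ℚ.* ι (↥ y)                      ≡⟨ ι-homo-* (↥ x) (↥ y) ⟨
      ι (↥ x ℤ.* ↥ y)                          ∎

  q^j∣m*n^k⇒q^j∣m : ∀ {m n j} k → m ≢ 0 → ¬ q ∣ n → q ℕ.^ j ∣ m ℕ.* n ℕ.^ k → q ℕ.^ j ∣ m
  q^j∣m*n^k⇒q^j∣m {m} {n} {j} k m≢0 q∤n q^j∣mnᵏ = ≤vℕ⇒q^j∣ m≢0 (begin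
    j                               ≤⟨ q^j∣⇒≤vℕ (m*n≢0 m≢0 nᵏ≢0) q^j∣mnᵏ ⟩
    vℕ q (m ℕ.* n ℕ.^ k)            ≡⟨ vℕ-* m≢0 nᵏ≢0 ⟩
    vℕ q m ℕ.+ vℕ q (n ℕ.^ k)       ≡⟨ cong (vℕ q m ℕ.+_) (trans (vℕ-^ k n≢0) (cong (k ℕ.*_) (q∤⇒vℕ≡0 q∤n))) ⟩
    vℕ q m ℕ.+ k ℕ.* 0              ≡⟨ cong (vℕ q m ℕ.+_) (ℕP.*-zeroʳ k) ⟩
    vℕ q m ℕ.+ 0                    ≡⟨ ℕP.+-identityʳ (vℕ q m) ⟩
    vℕ q m                          ∎)
    where
    open ℕP.≤-Reasoning
    n≢0 : n ≢ 0
    n≢0 = ℕ.≢-nonZero⁻¹ n {{q∤⇒nonZero q∤n}}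
    nᵏ≢0 : n ℕ.^ k ≢ 0
    nᵏ≢0 = n≢0 ∘ ℕP.m^n≡0⇒m≡0 n k

  q^r∤⇒vℕ<r : ∀ {n r} → n ≢ 0 → ¬ q ℕ.^ r ∣ n → vℕ q n ℕ.< r
  q^r∤⇒vℕ<r n≢0 q^r∤n = ℕP.≰⇒> (q^r∤n ∘ ≤vℕ⇒q^j∣ n≢0)

vℚ-integral : ∀ q x → x ≡ 0ℚ ⊎ Σ ℚ (λ k → ValQ q x k × IsInt k)
vℚ-integral q x with x ℚP.≟ 0ℚ
... | yes x≡0 = inj₁ x≡0
... | no x≢0  = inj₂ (ι (vℚ q x) , (x≢0 , refl) , vℚ q x , refl)

-- A prime cannot divide both C c and A B a b
record Coefficients (r : ℕ) (A B C : ℤ) : Set where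
  field
    A≢0 : A ≢ + 0
    B≢0 : B ≢ + 0
    C≢0 : C ≢ + 0
    coprime-AB : Coprime ℤ.∣ A ∣ ℤ.∣ B ∣
    coprime-AC : Coprime ℤ.∣ A ∣ ℤ.∣ C ∣
    coprime-BC : Coprime ℤ.∣ B ∣ ℤ.∣ C ∣
    A-free : ∀ ℓ → Prime ℓ → ¬ ℓ ℕ.^ r ∣ ℤ.∣ A ∣
    B-free : ∀ ℓ → Prime ℓ → ¬ ℓ ℕ.^ r ∣ ℤ.∣ B ∣
    C-free : ∀ ℓ → Prime ℓ → ¬ ℓ ℕ.^ r ∣ ℤ.∣ C ∣

record PrimitiveSolution (A B C : ℤ) (e f : ℕ) (a b c : ℤ) : Set where
  constructor solution
  field
    abc≢0 : a ℤ.* b ℤ.* c ≢ + 0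
    coprime-abc : ∀ d → d ∣ ℤ.∣ a ∣ → d ∣ ℤ.∣ b ∣ → d ∣ ℤ.∣ c ∣ → d ≡ 1
    equation : A ℤ.* a ℤ.^ e ℤ.+ B ℤ.* b ℤ.^ e ≡ C ℤ.* c ℤ.^ f

  a≢0 : a ≢ + 0
  a≢0 = i*j≢0⇒i≢0 {a} {b} (i*j≢0⇒i≢0 {a ℤ.* b} {c} abc≢0)

  b≢0 : b ≢ + 0
  b≢0 = i*j≢0⇒j≢0 {a} {b} (i*j≢0⇒i≢0 {a ℤ.* b} {c} abc≢0)

  c≢0 : c ≢ + 0
  c≢0 = i*j≢0⇒j≢0 {a ℤ.* b} {c} abc≢0

module _ {q r e f : ℕ} (q-prime : Prime q) (1≤r : 1 ℕ.≤ r) (r≤e : r ℕ.≤ e) (r≤f : r ℕ.≤ f)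
         {A B C a b c : ℤ} (coefficients : Coefficients r A B C) (solution : PrimitiveSolution A B C e f a b c) where

  open Coefficients coefficients
  open PrimitiveSolution solution

  private
    _∣ℤ_ : ℕ → ℤ → Set
    d ∣ℤ z = + d ℤDS.∣ z

    ∣-term : ∀ {d} K k n → d ∣ ℤ.∣ K ∣ ℕ.* ℤ.∣ k ∣ ℕ.^ n → d ∣ℤ (K ℤ.* k ℤ.^ n)
    ∣-term K k n d∣ = ℤDS.∣ᵤ⇒∣ (subst (_ ∣_) (sym (∣K*kⁿ∣ K k n)) d∣)

    q∣term : ∀ K {k n} → q ∣ℤ k → 1 ℕ.≤ n → q ∣ℤ (K ℤ.* k ℤ.^ n)
    q∣term K {k} {n} q∣k 1≤n = ∣-term K k n (d∣n⇒d∣m*n^k ℤ.∣ K ∣ (ℤDS.∣⇒∣ᵤ q∣k) 1≤n)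

    q^r∣term : ∀ K {k n} → q ∣ℤ k → r ℕ.≤ n → (q ℕ.^ r) ∣ℤ (K ℤ.* k ℤ.^ n)
    q^r∣term K {k} {n} q∣k r≤n = ∣-term K k n (d∣n⇒d^j∣m*n^k ℤ.∣ K ∣ (ℤDS.∣⇒∣ᵤ q∣k) r≤n)

    q∣term⇒ : ∀ K k n → q ∣ℤ (K ℤ.* k ℤ.^ n) → q ∣ℤ K ⊎ q ∣ℤ k
    q∣term⇒ K k n q∣Kkⁿ = Sum.map ℤDS.∣ᵤ⇒∣ ℤDS.∣ᵤ⇒∣
      (prime∣m*n^k⇒∣m⊎∣n n q-prime (subst (q ∣_) (∣K*kⁿ∣ K k n) (ℤDS.∣⇒∣ᵤ q∣Kkⁿ)))

    q^r∤term : ∀ {K k} n → K ≢ + 0 → ¬ q ℕ.^ r ∣ ℤ.∣ K ∣ → ¬ q ∣ℤ k → ¬ (q ℕ.^ r) ∣ℤ (K ℤ.* k ℤ.^ n)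
    q^r∤term {K} {k} n K≢0 K-free q∤k q^r∣Kkⁿ = K-free (q^j∣m*n^k⇒q^j∣m q-prime {j = r} n (K≢0 ∘ ℤP.∣i∣≡0⇒i≡0)
      (q∤k ∘ ℤDS.∣ᵤ⇒∣) (subst (_ ∣_) (∣K*kⁿ∣ K k n) (ℤDS.∣⇒∣ᵤ q^r∣Kkⁿ)))

    q∤all-bases : q ∣ℤ a → q ∣ℤ b → q ∣ℤ c → ⊥
    q∤all-bases q∣a q∣b q∣c = ℕ.nonTrivial⇒≢1 {{prime⇒nonTrivial q-prime}}
      (coprime-abc q (ℤDS.∣⇒∣ᵤ q∣a) (ℤDS.∣⇒∣ᵤ q∣b) (ℤDS.∣⇒∣ᵤ q∣c))

    q∤two-coefficients : ∀ {K L} → Coprime ℤ.∣ K ∣ ℤ.∣ L ∣ → q ∣ℤ K → q ∣ℤ L → ⊥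
    q∤two-coefficients coprime q∣K q∣L = prime∣m∣n⇒¬coprime q-prime (ℤDS.∣⇒∣ᵤ q∣K) (ℤDS.∣⇒∣ᵤ q∣L) coprime

    q∤a-b : q ∣ℤ a → q ∣ℤ b → ⊥
    q∤a-b q∣a q∣b = q^r∤term f C≢0 (C-free q q-prime) (q∤all-bases q∣a q∣b)
      (subst ((q ℕ.^ r) ∣ℤ_) equation (ℤDS.∣m∣n⇒∣m+n (q^r∣term A q∣a r≤e) (q^r∣term B q∣b r≤e)))

    q∤a-c : q ∣ℤ a → q ∣ℤ c → ⊥
    q∤a-c q∣a q∣c = q^r∤term e B≢0 (B-free q q-prime) (λ q∣b → q∤all-bases q∣a q∣b q∣c)
      (ℤDS.∣m+n∣m⇒∣n (subst ((q ℕ.^ r) ∣ℤ_) (sym equation) (q^r∣term C q∣c r≤f)) (q^r∣term A q∣a r≤e))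

    q∤b-c : q ∣ℤ b → q ∣ℤ c → ⊥
    q∤b-c q∣b q∣c = q^r∤term e A≢0 (A-free q q-prime) (λ q∣a → q∤all-bases q∣a q∣b q∣c)
      (ℤDS.∣m+n∣n⇒∣m (subst ((q ℕ.^ r) ∣ℤ_) (sym equation) (q^r∣term C q∣c r≤f)) (q^r∣term B q∣b r≤e))

    q∤Cc-ABab : q ∣ℤ C ⊎ q ∣ℤ c → q ∣ℤ A ⊎ q ∣ℤ B ⊎ q ∣ℤ a ⊎ q ∣ℤ b → ⊥
    q∤Cc-ABab q∣Cc q∣ABab = split (q∣term⇒ A a e q∣T₁) (q∣term⇒ B b e q∣T₂) (q∣term⇒ C c f q∣T₃)
      where
      1≤e = ℕP.≤-trans 1≤r r≤e
      1≤f = ℕP.≤-trans 1≤r r≤f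
      q∣T₃ : q ∣ℤ (C ℤ.* c ℤ.^ f)
      q∣T₃ = [ ℤDS.∣m⇒∣m*n (c ℤ.^ f) , (λ q∣c → q∣term C q∣c 1≤f) ]′ q∣Cc
      q∣T₁+T₂ : q ∣ℤ (A ℤ.* a ℤ.^ e ℤ.+ B ℤ.* b ℤ.^ e)
      q∣T₁+T₂ = subst (q ∣ℤ_) (sym equation) q∣T₃
      q∣T₁⊎T₂ : q ∣ℤ A ⊎ q ∣ℤ B ⊎ q ∣ℤ a ⊎ q ∣ℤ b → q ∣ℤ (A ℤ.* a ℤ.^ e) ⊎ q ∣ℤ (B ℤ.* b ℤ.^ e)
      q∣T₁⊎T₂ (inj₁ q∣A)               = inj₁ (ℤDS.∣m⇒∣m*n (a ℤ.^ e) q∣A)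
      q∣T₁⊎T₂ (inj₂ (inj₁ q∣B))        = inj₂ (ℤDS.∣m⇒∣m*n (b ℤ.^ e) q∣B)
      q∣T₁⊎T₂ (inj₂ (inj₂ (inj₁ q∣a))) = inj₁ (q∣term A q∣a 1≤e)
      q∣T₁⊎T₂ (inj₂ (inj₂ (inj₂ q∣b))) = inj₂ (q∣term B q∣b 1≤e)
      q∣T₁ : q ∣ℤ (A ℤ.* a ℤ.^ e)
      q∣T₁ = [ id , ℤDS.∣m+n∣n⇒∣m q∣T₁+T₂ ]′ (q∣T₁⊎T₂ q∣ABab)
      q∣T₂ : q ∣ℤ (B ℤ.* b ℤ.^ e)
      q∣T₂ = [ ℤDS.∣m+n∣m⇒∣n q∣T₁+T₂ , id ]′ (q∣T₁⊎T₂ q∣ABab)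
      split : q ∣ℤ A ⊎ q ∣ℤ a → q ∣ℤ B ⊎ q ∣ℤ b → q ∣ℤ C ⊎ q ∣ℤ c → ⊥
      split (inj₁ q∣A) (inj₁ q∣B) _          = q∤two-coefficients coprime-AB q∣A q∣B
      split (inj₁ q∣A) (inj₂ _)   (inj₁ q∣C) = q∤two-coefficients coprime-AC q∣A q∣C
      split (inj₁ _)   (inj₂ q∣b) (inj₂ q∣c) = q∤b-c q∣b q∣c
      split (inj₂ _)   (inj₁ q∣B) (inj₁ q∣C) = q∤two-coefficients coprime-BC q∣B q∣C
      split (inj₂ q∣a) (inj₁ _)   (inj₂ q∣c) = q∤a-c q∣a q∣c
      split (inj₂ q∣a) (inj₂ q∣b) _          = q∤a-b q∣a q∣b

    q∤ABab : q ∣ℤ C ⊎ q ∣ℤ c → ¬ + q ℤD.∣ A × ¬ + q ℤD.∣ B × ¬ + q ℤD.∣ a × ¬ + q ℤD.∣ b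
    q∤ABab q∣Cc = q∤Cc-ABab q∣Cc ∘ inj₁ ∘ ℤDS.∣ᵤ⇒∣ , q∤Cc-ABab q∣Cc ∘ inj₂ ∘ inj₁ ∘ ℤDS.∣ᵤ⇒∣ ,
                  q∤Cc-ABab q∣Cc ∘ inj₂ ∘ inj₂ ∘ inj₁ ∘ ℤDS.∣ᵤ⇒∣ , q∤Cc-ABab q∣Cc ∘ inj₂ ∘ inj₂ ∘ inj₂ ∘ ℤDS.∣ᵤ⇒∣

  separation : (¬ + q ℤD.∣ C × ¬ + q ℤD.∣ c) ⊎ (¬ + q ℤD.∣ A × ¬ + q ℤD.∣ B × ¬ + q ℤD.∣ a × ¬ + q ℤD.∣ b)
  separation with q ℕD.∣? ℤ.∣ C ∣ | q ℕD.∣? ℤ.∣ c ∣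
  ... | no q∤C  | no q∤c  = inj₁ (q∤C , q∤c)
  ... | yes q∣C | _       = inj₂ (q∤ABab (inj₁ (ℤDS.∣ᵤ⇒∣ q∣C)))
  ... | no _    | yes q∣c = inj₂ (q∤ABab (inj₂ (ℤDS.∣ᵤ⇒∣ q∣c)))

-- Case (a)

-- Here γ = v_q(C), κ = v_q(c) and P = v_q(A a^p B b^p), so that ν = P − 2(γ + r κ); the
-- disjunction is what the separation lemma gives.
2[0+r*0]≡0 : ∀ r → 2 ℕ.* (0 ℕ.+ r ℕ.* 0) ≡ 0
2[0+r*0]≡0 = ℕ-solve-∀

case-a-ν≥0 : ∀ {r γ κ P} → 1 ℕ.≤ r → (γ ≡ 0 × κ ≡ 0) ⊎ P ≡ 0 → 2 ℕ.* (γ ℕ.+ r ℕ.* κ) ℕ.≤ P → γ ℕ.+ κ ≡ 0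
case-a-ν≥0 _ (inj₁ (refl , refl)) _ = refl
case-a-ν≥0 {r} {γ} {κ} 1≤r (inj₂ refl) 2x≤0 = cong₂ ℕ._+_ γ≡0 κ≡0
  where
  x≡0 : γ ℕ.+ r ℕ.* κ ≡ 0
  x≡0 = ℕP.m+n≡0⇒m≡0 _ (ℕP.n≤0⇒n≡0 2x≤0)
  γ≡0 : γ ≡ 0
  γ≡0 = ℕP.m+n≡0⇒m≡0 γ x≡0
  κ≡0 : κ ≡ 0
  κ≡0 = ℕP.m*n≡0⇒m≡0 κ r {{ℕ.>-nonZero 1≤r}} (trans (ℕP.*-comm κ r) (ℕP.m+n≡0⇒n≡0 γ x≡0))

case-a-ν≤0 : ∀ {r γ κ P} (i : ℤ) → Prime r → 2 ℕ.< r → γ ℕ.< r → (γ ≡ 0 × κ ≡ 0) ⊎ P ≡ 0 →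
             P ℕ.≤ 2 ℕ.* (γ ℕ.+ r ℕ.* κ) → + P ℤ.- + (2 ℕ.* (γ ℕ.+ r ℕ.* κ)) ≡ i ℤ.* + r →
             2 ℕ.* r ℕ.* (γ ℕ.+ κ) ℕ.+ P ≡ 2 ℕ.* (γ ℕ.+ r ℕ.* κ)
case-a-ν≤0 {r} {P = P} i _ _ _ (inj₁ (refl , refl)) P≤2x _ =
  trans (cong₂ ℕ._+_ (ℕP.*-zeroʳ (2 ℕ.* r)) (ℕP.n≤0⇒n≡0 (subst (P ℕ.≤_) (2[0+r*0]≡0 r) P≤2x))) (sym (2[0+r*0]≡0 r))
case-a-ν≤0 {r} {γ} {κ} i r-prime 2<r γ<r (inj₂ refl) _ eq =
  subst (λ γ → 2 ℕ.* r ℕ.* (γ ℕ.+ κ) ℕ.+ 0 ≡ 2 ℕ.* (γ ℕ.+ r ℕ.* κ)) (sym γ≡0) (identity r κ)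
  where
  regroup : ∀ γ κ r → 2 ℕ.* (γ ℕ.+ r ℕ.* κ) ≡ r ℕ.* (2 ℕ.* κ) ℕ.+ 2 ℕ.* γ
  regroup = ℕ-solve-∀
  r∣2γ : r ∣ 2 ℕ.* γ
  r∣2γ = ℕD.∣m+n∣m⇒∣n (subst (r ∣_) (regroup γ κ r) (r∣m-n∧r∣m⇒r∣n i eq (r ℕD.∣0))) (ℕD.m∣m*n (2 ℕ.* κ))
  γ≡0 : γ ≡ 0
  γ≡0 = prime∣m*n⇒n≡0 r-prime (s≤s z≤n) 2<r γ<r r∣2γ
  identity : ∀ r κ → 2 ℕ.* r ℕ.* (0 ℕ.+ κ) ℕ.+ 0 ≡ 2 ℕ.* (0 ℕ.+ r ℕ.* κ)
  identity = ℕ-solve-∀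

case-a-ν≢-odd : ∀ {r γ κ P} n → (γ ≡ 0 × κ ≡ 0) ⊎ P ≡ 0 → 2 ℕ.* (γ ℕ.+ r ℕ.* κ) ≢ P ℕ.+ suc (2 ℕ.* n)
case-a-ν≢-odd {r} {P = P} n (inj₁ (refl , refl)) eq = ℕP.0≢1+n (trans (sym (2[0+r*0]≡0 r)) (trans eq (ℕP.+-suc P _)))
case-a-ν≢-odd {r} {γ} {κ} n (inj₂ refl) eq = ℕP.even≢odd (γ ℕ.+ r ℕ.* κ) n eq

s[s-1]x²≡-yz : ∀ {s x y z} → s ℚ.* x ≡ y → x ≡ y ℚ.+ z → s ℚ.* (s ℚ.- 1ℚ) ℚ.* (x ℚ.* x) ≡ ℚ.- (y ℚ.* z)
s[s-1]x²≡-yz {s} {x} {y} {z} sx≡y x≡y+z = begin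
  s ℚ.* (s ℚ.- 1ℚ) ℚ.* (x ℚ.* x)       ≡⟨ factor s x ⟩
  s ℚ.* x ℚ.* (s ℚ.* x ℚ.- x)          ≡⟨ cong (λ t → t ℚ.* (t ℚ.- x)) sx≡y ⟩
  y ℚ.* (y ℚ.- x)                      ≡⟨ cong (λ t → y ℚ.* (y ℚ.- t)) x≡y+z ⟩
  y ℚ.* (y ℚ.- (y ℚ.+ z))              ≡⟨ cancel y z ⟩
  ℚ.- (y ℚ.* z)                        ∎
  where
  open ≡-Reasoning
  factor : ∀ s x → s ℚ.* (s ℚ.- 1ℚ) ℚ.* (x ℚ.* x) ≡ s ℚ.* x ℚ.* (s ℚ.* x ℚ.- x)
  factor = RingSolver.solve-∀ ℚ-ring
  cancel : ∀ y z → y ℚ.* (y ℚ.- (y ℚ.+ z)) ≡ ℚ.- (y ℚ.* z)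
  cancel = RingSolver.solve-∀ ℚ-ring

module CaseA {r p : ℕ} (r-prime : Prime r) (5≤r : 5 ℕ.≤ r) (r<p : r ℕ.< p) {A B C a b c : ℤ}
             (coefficients : Coefficients r A B C) (solution : PrimitiveSolution A B C p r a b c)
             (s₀ : ℚ) (s₀-def : s₀ ℚ.* ι (C ℤ.* c ℤ.^ r) ≡ ι (A ℤ.* a ℤ.^ p))
             {q : ℕ} (q-prime : Prime q) {ν : ℚ} (ν-def : ValQ q (s₀ ℚ.* (s₀ ℚ.- 1ℚ)) ν) where

  open Coefficients coefficients
  open PrimitiveSolution solution

  private
    X Y Z : ℤ
    X = C ℤ.* c ℤ.^ r
    Y = A ℤ.* a ℤ.^ p
    Z = B ℤ.* b ℤ.^ p

    X≢0 : X ≢ + 0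
    X≢0 = i*j≢0 C≢0 (i^n≢0 r c≢0)
    Y≢0 : Y ≢ + 0
    Y≢0 = i*j≢0 A≢0 (i^n≢0 p a≢0)
    Z≢0 : Z ≢ + 0
    Z≢0 = i*j≢0 B≢0 (i^n≢0 p b≢0)
    Cc≢0 : C ℤ.* c ≢ + 0
    Cc≢0 = i*j≢0 C≢0 c≢0

    γ κ P : ℕ
    γ = vℤ q C
    κ = vℤ q c
    P = vℤ q Y ℕ.+ vℤ q Z

    1≤r : 1 ℕ.≤ r
    1≤r = ℕP.≤-trans (s≤s z≤n) 5≤r

    γ<r : γ ℕ.< r
    γ<r = q^r∤⇒vℕ<r q-prime (C≢0 ∘ ℤP.∣i∣≡0⇒i≡0) (C-free q q-prime)

    S≢0 : s₀ ℚ.* (s₀ ℚ.- 1ℚ) ≢ 0ℚ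
    S≢0 = proj₁ ν-def

    S-def : s₀ ℚ.* (s₀ ℚ.- 1ℚ) ℚ.* ι (X ℤ.* X) ≡ ι (ℤ.- (Y ℤ.* Z))
    S-def = begin
      s₀ ℚ.* (s₀ ℚ.- 1ℚ) ℚ.* ι (X ℤ.* X)    ≡⟨ cong (s₀ ℚ.* (s₀ ℚ.- 1ℚ) ℚ.*_) (ι-homo-* X X) ⟩
      s₀ ℚ.* (s₀ ℚ.- 1ℚ) ℚ.* (ι X ℚ.* ι X)  ≡⟨ s[s-1]x²≡-yz {s₀} s₀-def (trans (cong ι (sym equation)) (ι-homo-+ Y Z)) ⟩
      ℚ.- (ι Y ℚ.* ι Z)                     ≡⟨ cong ℚ.-_ (ι-homo-* Y Z) ⟨
      ℚ.- ι (Y ℤ.* Z)                       ≡⟨ ι-homo‿- (Y ℤ.* Z) ⟨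
      ι (ℤ.- (Y ℤ.* Z))                     ∎
      where open ≡-Reasoning

    ν≡ι[P-2x] : ν ≡ ι (+ P ℤ.- + (2 ℕ.* (γ ℕ.+ r ℕ.* κ)))
    ν≡ι[P-2x] = trans (proj₂ ν-def) (cong ι (begin
      vℚ q (s₀ ℚ.* (s₀ ℚ.- 1ℚ))
        ≡⟨ *ι≡ι⇒vℚ≡ q-prime (s₀ ℚ.* (s₀ ℚ.- 1ℚ)) (i*j≢0 X≢0 X≢0) (-i≢0 (i*j≢0 Y≢0 Z≢0)) S-def ⟩
      + vℤ q (ℤ.- (Y ℤ.* Z)) ℤ.- + vℤ q (X ℤ.* X)
        ≡⟨ cong₂ (λ u v → + u ℤ.- + v) vYZ vXX ⟩
      + P ℤ.- + (2 ℕ.* (γ ℕ.+ r ℕ.* κ)) ∎))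
      where
      open ≡-Reasoning
      x = γ ℕ.+ r ℕ.* κ
      vYZ : vℤ q (ℤ.- (Y ℤ.* Z)) ≡ P
      vYZ = trans (vℤ-neg q (Y ℤ.* Z)) (vℤ-* q-prime Y≢0 Z≢0)
      vXX : vℤ q (X ℤ.* X) ≡ 2 ℕ.* x
      vXX = begin
        vℤ q (X ℤ.* X)         ≡⟨ vℤ-* q-prime X≢0 X≢0 ⟩
        vℤ q X ℕ.+ vℤ q X      ≡⟨ cong (λ v → v ℕ.+ v) (vℤ[K*kⁿ] q-prime r C≢0 c≢0) ⟩
        x ℕ.+ x                ≡⟨ cong (x ℕ.+_) (ℕP.+-identityʳ x) ⟨
        2 ℕ.* x                ∎

    ι⁻¹ν : ∀ {i} → ν ≡ ι i → + P ℤ.- + (2 ℕ.* (γ ℕ.+ r ℕ.* κ)) ≡ i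
    ι⁻¹ν ν≡ιi = ι-injective (trans (sym ν≡ι[P-2x]) ν≡ιi)

    separated : (γ ≡ 0 × κ ≡ 0) ⊎ P ≡ 0
    separated with separation q-prime 1≤r (ℕP.<⇒≤ r<p) ℕP.≤-refl coefficients solution
    ... | inj₁ (q∤C , q∤c)             = inj₁ (q∤⇒vℤ≡0 q-prime C q∤C , q∤⇒vℤ≡0 q-prime c q∤c)
    ... | inj₂ (q∤A , q∤B , q∤a , q∤b) = inj₂ (cong₂ ℕ._+_ (q∤K,k⇒vℤ[K*kⁿ]≡0 q-prime p A≢0 a≢0 q∤A q∤a)
                                                           (q∤K,k⇒vℤ[K*kⁿ]≡0 q-prime p B≢0 b≢0 q∤B q∤b))

  ν≥0⇒vδ≡0 : 0ℚ ℚ.≤ ν → ValQ q (ι (C ℤ.* c)) 0ℚ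
  ν≥0⇒vδ≡0 0≤ν = ι≢0 Cc≢0 , sym (cong ι (begin
    vℚ q (ι (C ℤ.* c))     ≡⟨ vℚ-ι q-prime Cc≢0 ⟩
    + vℤ q (C ℤ.* c)       ≡⟨ cong +_ (vℤ-* q-prime C≢0 c≢0) ⟩
    + (γ ℕ.+ κ)            ≡⟨ cong +_ (case-a-ν≥0 1≤r separated (0≤ι[m-n]⇒n≤m (subst (0ℚ ℚ.≤_) ν≡ι[P-2x] 0≤ν))) ⟩
    + 0                    ∎))
    where open ≡-Reasoning

  ν≤0⇒v[δ²ʳS]≡0 : ν ℚ.≤ 0ℚ → Σ ℤ (λ i → ν ≡ ι (i ℤ.* + r)) →
                  ValQ q (ι (C ℤ.* c) ^ℚ (2 ℕ.* r) ℚ.* (s₀ ℚ.* (s₀ ℚ.- 1ℚ))) 0ℚ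
  ν≤0⇒v[δ²ʳS]≡0 ν≤0 (i , ν≡ir) = p*q≢0 δ²ʳ≢0 S≢0 , sym (cong ι (begin
    vℚ q (δ²ʳ ℚ.* (s₀ ℚ.* (s₀ ℚ.- 1ℚ)))
      ≡⟨ vℚ-* q-prime δ²ʳ≢0 S≢0 ⟩
    vℚ q δ²ʳ ℤ.+ vℚ q (s₀ ℚ.* (s₀ ℚ.- 1ℚ))
      ≡⟨ cong₂ ℤ._+_ vδ²ʳ (sym (ι⁻¹ν (proj₂ ν-def))) ⟩
    + (2 ℕ.* r ℕ.* (γ ℕ.+ κ)) ℤ.+ (+ P ℤ.- + (2 ℕ.* (γ ℕ.+ r ℕ.* κ)))
      ≡⟨ t+m≡n⇒t+[m-n]≡0 (case-a-ν≤0 i r-prime 2<r γ<r separated P≤2x P-2x≡ir) ⟩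
    + 0 ∎))
    where
    open ≡-Reasoning
    δ²ʳ : ℚ
    δ²ʳ = ι (C ℤ.* c) ^ℚ (2 ℕ.* r)
    δ²ʳ≢0 : δ²ʳ ≢ 0ℚ
    δ²ʳ≢0 = subst (_≢ 0ℚ) (ι-homo-^ (C ℤ.* c) (2 ℕ.* r)) (ι≢0 (i^n≢0 (2 ℕ.* r) Cc≢0))
    vδ²ʳ : vℚ q δ²ʳ ≡ + (2 ℕ.* r ℕ.* (γ ℕ.+ κ))
    vδ²ʳ = begin
      vℚ q δ²ʳ
        ≡⟨ cong (vℚ q) (ι-homo-^ (C ℤ.* c) (2 ℕ.* r)) ⟨
      vℚ q (ι ((C ℤ.* c) ℤ.^ (2 ℕ.* r))) ≡⟨ vℚ-ι q-prime (i^n≢0 (2 ℕ.* r) Cc≢0) ⟩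
      + vℤ q ((C ℤ.* c) ℤ.^ (2 ℕ.* r))
        ≡⟨ cong +_ (trans (vℤ-^ q-prime (2 ℕ.* r) Cc≢0) (cong (2 ℕ.* r ℕ.*_) (vℤ-* q-prime C≢0 c≢0))) ⟩
      + (2 ℕ.* r ℕ.* (γ ℕ.+ κ)) ∎
    2<r : 2 ℕ.< r
    2<r = ℕP.<-≤-trans (s≤s (s≤s (s≤s z≤n))) 5≤r
    P≤2x : P ℕ.≤ 2 ℕ.* (γ ℕ.+ r ℕ.* κ)
    P≤2x = ι[m-n]≤0⇒m≤n (subst (ℚ._≤ 0ℚ) ν≡ι[P-2x] ν≤0)
    P-2x≡ir : + P ℤ.- + (2 ℕ.* (γ ℕ.+ r ℕ.* κ)) ≡ i ℤ.* + r
    P-2x≡ir = ι⁻¹ν ν≡ir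

  ν≢-odd : ∀ n → ν ≢ ι (ℤ.- + suc (2 ℕ.* n))
  ν≢-odd n ν≡-odd = case-a-ν≢-odd {r} n separated (m-n≡-k⇒n≡m+k (ι⁻¹ν ν≡-odd))

-- Case (b)

-- Here r = 2k + 1, t = v_q(AB), s = v_q(ABab), x = v_q(C c^p) and w = v_q(16), so that
-- ν = 2(k t + x) − (w + r s).
case-b-ν≥0 : ∀ {r k t s x w} → r ≡ suc (2 ℕ.* k) → t ℕ.≤ s → x ≡ 0 ⊎ s ≡ 0 →
             w ℕ.+ r ℕ.* s ℕ.≤ 2 ℕ.* (k ℕ.* t ℕ.+ x) → s ≡ 0
case-b-ν≥0 _ _ (inj₂ s≡0) _ = s≡0
case-b-ν≥0 {k = k} {t} {s} {w = w} refl t≤s (inj₁ refl) Q≤P = ℕP.n≤0⇒n≡0 (ℕP.+-cancelʳ-≤ (2 ℕ.* (k ℕ.* s)) s 0 (begin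
  s ℕ.+ 2 ℕ.* (k ℕ.* s)          ≡⟨ expand k s ⟩
  suc (2 ℕ.* k) ℕ.* s            ≤⟨ ℕP.m≤n+m _ w ⟩
  w ℕ.+ suc (2 ℕ.* k) ℕ.* s      ≤⟨ Q≤P ⟩
  2 ℕ.* (k ℕ.* t ℕ.+ 0)          ≡⟨ cong (2 ℕ.*_) (ℕP.+-identityʳ (k ℕ.* t)) ⟩
  2 ℕ.* (k ℕ.* t)                ≤⟨ ℕP.*-monoʳ-≤ 2 (ℕP.*-monoʳ-≤ k t≤s) ⟩
  2 ℕ.* (k ℕ.* s)                ∎))
  where
  open ℕP.≤-Reasoning
  expand : ∀ k s → s ℕ.+ 2 ℕ.* (k ℕ.* s) ≡ suc (2 ℕ.* k) ℕ.* s
  expand = ℕ-solve-∀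

case-b-ν≤0 : ∀ {r k t s x} (i : ℤ) → r ≡ suc (2 ℕ.* k) → Prime r → 1 ℕ.≤ k → t ℕ.< r → x ≡ 0 ⊎ s ≡ 0 →
             2 ℕ.* (k ℕ.* t ℕ.+ x) ℕ.≤ r ℕ.* s → + (2 ℕ.* (k ℕ.* t ℕ.+ x)) ℤ.- + (r ℕ.* s) ≡ i ℤ.* + r →
             2 ℕ.* (k ℕ.* t ℕ.+ x) ≡ 0
case-b-ν≤0 {k = k} {t} {x = x} i refl _ _ _ (inj₂ refl) P≤rs _ =
  ℕP.n≤0⇒n≡0 (subst (2 ℕ.* (k ℕ.* t ℕ.+ x) ℕ.≤_) (ℕP.*-zeroʳ (suc (2 ℕ.* k))) P≤rs)
case-b-ν≤0 {k = k} {t} {s} i refl r-prime 1≤k t<r (inj₁ refl) _ eq =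
  subst (λ t → 2 ℕ.* (k ℕ.* t ℕ.+ 0) ≡ 0) (sym t≡0) (vanish k)
  where
  regroup : ∀ k t → 2 ℕ.* (k ℕ.* t ℕ.+ 0) ≡ (2 ℕ.* k) ℕ.* t
  regroup = ℕ-solve-∀
  vanish : ∀ k → 2 ℕ.* (k ℕ.* 0 ℕ.+ 0) ≡ 0
  vanish = ℕ-solve-∀
  r∣2kt : suc (2 ℕ.* k) ∣ (2 ℕ.* k) ℕ.* t
  r∣2kt = subst (suc (2 ℕ.* k) ∣_) (regroup k t) (r∣m-n∧r∣n⇒r∣m {r = suc (2 ℕ.* k)} i eq (ℕD.m∣m*n s))
  t≡0 : t ≡ 0
  t≡0 = prime∣m*n⇒n≡0 r-prime (ℕP.<-≤-trans (s≤s z≤n) (ℕP.*-monoʳ-≤ 2 1≤k)) ℕP.≤-refl t<r r∣2kt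

case-b-ν≢-1,-3 : ∀ {r k t s x} j → r ≡ suc (2 ℕ.* k) → j ℕ.≤ 1 → t ℕ.≤ s → x ≡ 0 ⊎ s ≡ 0 →
                 4 ℕ.+ r ℕ.* s ≢ 2 ℕ.* (k ℕ.* t ℕ.+ x) ℕ.+ suc (2 ℕ.* j)
case-b-ν≢-1,-3 {k = k} {t} {x = x} j refl _ t≤0 (inj₂ refl) eq rewrite ℕP.n≤0⇒n≡0 t≤0 =
  ℕP.even≢odd 2 (x ℕ.+ j) (trans (lhs k) (trans eq (rhs k x j)))
  where
  lhs : ∀ k → 2 ℕ.* 2 ≡ 4 ℕ.+ suc (2 ℕ.* k) ℕ.* 0
  lhs = ℕ-solve-∀
  rhs : ∀ k x j → 2 ℕ.* (k ℕ.* 0 ℕ.+ x) ℕ.+ suc (2 ℕ.* j) ≡ suc (2 ℕ.* (x ℕ.+ j))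
  rhs = ℕ-solve-∀
case-b-ν≢-1,-3 {k = k} {t} {s} j refl j≤1 t≤s (inj₁ refl) eq =
  ℕP.<⇒≱ (s≤s (s≤s (ℕP.*-monoʳ-≤ 2 j≤1))) (ℕP.+-cancelˡ-≤ (suc (2 ℕ.* k) ℕ.* s) 4 (suc (2 ℕ.* j)) (begin
  suc (2 ℕ.* k) ℕ.* s ℕ.+ 4                   ≡⟨ ℕP.+-comm _ 4 ⟩
  4 ℕ.+ suc (2 ℕ.* k) ℕ.* s                   ≡⟨ eq ⟩
  2 ℕ.* (k ℕ.* t ℕ.+ 0) ℕ.+ suc (2 ℕ.* j)     ≤⟨ ℕP.+-monoˡ-≤ (suc (2 ℕ.* j)) P≤rs ⟩
  suc (2 ℕ.* k) ℕ.* s ℕ.+ suc (2 ℕ.* j)       ∎))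
  where
  open ℕP.≤-Reasoning
  expand : ∀ k s → 2 ℕ.* (k ℕ.* s) ℕ.+ s ≡ suc (2 ℕ.* k) ℕ.* s
  expand = ℕ-solve-∀
  P≤rs : 2 ℕ.* (k ℕ.* t ℕ.+ 0) ℕ.≤ suc (2 ℕ.* k) ℕ.* s
  P≤rs = begin
    2 ℕ.* (k ℕ.* t ℕ.+ 0)      ≡⟨ cong (2 ℕ.*_) (ℕP.+-identityʳ (k ℕ.* t)) ⟩
    2 ℕ.* (k ℕ.* t)            ≤⟨ ℕP.*-monoʳ-≤ 2 (ℕP.*-monoʳ-≤ k t≤s) ⟩
    2 ℕ.* (k ℕ.* s)            ≤⟨ ℕP.m≤m+n _ s ⟩
    2 ℕ.* (k ℕ.* s) ℕ.+ s      ≡⟨ expand k s ⟩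
    suc (2 ℕ.* k) ℕ.* s        ∎

module _ (d : ℚ) where
  open Quad d

  z₀^[2j] : ∀ j → z₀ ^Q (2 ℕ.* j) ≡ fromℚ (d ^ℚ j)
  z₀^[2j+1] : ∀ j → z₀ ^Q suc (2 ℕ.* j) ≡ 0ℚ + d ^ℚ j z₀

  z₀^[2j] zero    = refl
  z₀^[2j] (suc j) = begin
    z₀ ^Q (2 ℕ.* suc j)             ≡⟨ cong (z₀ ^Q_) (double-suc j) ⟩
    z₀ ⊗ (z₀ ^Q suc (2 ℕ.* j))      ≡⟨ cong (z₀ ⊗_) (z₀^[2j+1] j) ⟩
    z₀ ⊗ (0ℚ + d ^ℚ j z₀)           ≡⟨ cong₂ _+_z₀ (re-identity d (d ^ℚ j)) (im-identity (d ^ℚ j)) ⟩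
    fromℚ (d ^ℚ suc j)              ∎
    where
    open ≡-Reasoning
    double-suc : ∀ j → 2 ℕ.* suc j ≡ suc (suc (2 ℕ.* j))
    double-suc = ℕ-solve-∀
    re-identity : ∀ d x → 0ℚ ℚ.* 0ℚ ℚ.+ d ℚ.* (1ℚ ℚ.* x) ≡ d ℚ.* x
    re-identity = RingSolver.solve-∀ ℚ-ring
    im-identity : ∀ x → 0ℚ ℚ.* x ℚ.+ 1ℚ ℚ.* 0ℚ ≡ 0ℚ
    im-identity = RingSolver.solve-∀ ℚ-ring

  z₀^[2j+1] j = trans (cong (z₀ ⊗_) (z₀^[2j] j)) (cong₂ _+_z₀ (re-identity d (d ^ℚ j)) (im-identity (d ^ℚ j)))
    where
    re-identity : ∀ d x → 0ℚ ℚ.* x ℚ.+ d ℚ.* (1ℚ ℚ.* 0ℚ) ≡ 0ℚ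
    re-identity = RingSolver.solve-∀ ℚ-ring
    im-identity : ∀ x → 0ℚ ℚ.* 0ℚ ℚ.+ 1ℚ ℚ.* x ≡ x
    im-identity = RingSolver.solve-∀ ℚ-ring

  fromℚ-⊗-rational : ∀ x y → fromℚ x ⊗ (y + 0ℚ z₀) ≡ (x ℚ.* y) + 0ℚ z₀
  fromℚ-⊗-rational x y = cong₂ _+_z₀ (re-identity d x y) (im-identity x y)
    where
    re-identity : ∀ d x y → x ℚ.* y ℚ.+ d ℚ.* (0ℚ ℚ.* 0ℚ) ≡ x ℚ.* y
    re-identity = RingSolver.solve-∀ ℚ-ring
    im-identity : ∀ x y → x ℚ.* 0ℚ ℚ.+ 0ℚ ℚ.* y ≡ 0ℚ
    im-identity = RingSolver.solve-∀ ℚ-ring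

  s₀-from-defining-equation : ∀ {s e m} → e ≢ 0ℚ →
    s ⊗ (fromℚ (ι (+ 4)) ⊗ (0ℚ + e z₀)) ≡ (fromℚ (ι (+ 2)) ⊗ (0ℚ + e z₀)) ⊕ fromℚ m →
    re s ≡ ½ × d ℚ.* (im s ℚ.* (ι (+ 4) ℚ.* e)) ≡ m
  s₀-from-defining-equation {s} {e} {m} e≢0 eq =
    u≡½ , trans (sym (re-lhs (re s) (im s) d e)) (trans (cong re eq) (re-rhs d e m))
    where
    re-lhs : ∀ u w d e → u ℚ.* (ι (+ 4) ℚ.* 0ℚ ℚ.+ d ℚ.* (0ℚ ℚ.* e)) ℚ.+ d ℚ.* (w ℚ.* (ι (+ 4) ℚ.* e ℚ.+ 0ℚ ℚ.* 0ℚ))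
                         ≡ d ℚ.* (w ℚ.* (ι (+ 4) ℚ.* e))
    re-lhs = RingSolver.solve-∀ ℚ-ring
    re-rhs : ∀ d e m → (ι (+ 2) ℚ.* 0ℚ ℚ.+ d ℚ.* (0ℚ ℚ.* e)) ℚ.+ m ≡ m
    re-rhs = RingSolver.solve-∀ ℚ-ring
    im-lhs : ∀ u w d e → u ℚ.* (ι (+ 4) ℚ.* e ℚ.+ 0ℚ ℚ.* 0ℚ) ℚ.+ w ℚ.* (ι (+ 4) ℚ.* 0ℚ ℚ.+ d ℚ.* (0ℚ ℚ.* e))
                         ≡ (u ℚ.* ι (+ 4)) ℚ.* e
    im-lhs = RingSolver.solve-∀ ℚ-ring
    im-rhs : ∀ e → (ι (+ 2) ℚ.* e ℚ.+ 0ℚ ℚ.* 0ℚ) ℚ.+ 0ℚ ≡ ι (+ 2) ℚ.* e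
    im-rhs = RingSolver.solve-∀ ℚ-ring
    4u≡2 : re s ℚ.* ι (+ 4) ≡ ι (+ 2)
    4u≡2 = *-cancelʳ-≡ e≢0 (trans (sym (im-lhs (re s) (im s) d e)) (trans (cong im eq) (im-rhs e)))
    u≡½ : re s ≡ ½
    u≡½ = begin
      re s                                    ≡⟨ ℚP.*-identityʳ (re s) ⟨
      re s ℚ.* (ι (+ 4) ℚ.* (+ 1 ℚ./ 4))      ≡⟨ ℚP.*-assoc (re s) (ι (+ 4)) (+ 1 ℚ./ 4) ⟨
      re s ℚ.* ι (+ 4) ℚ.* (+ 1 ℚ./ 4)        ≡⟨ cong (ℚ._* (+ 1 ℚ./ 4)) 4u≡2 ⟩
      ι (+ 2) ℚ.* (+ 1 ℚ./ 4)                 ≡⟨⟩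
      ½                                       ∎
      where open ≡-Reasoning

  re≡½⇒im[s⊗[s⊖1]]≡0 : ∀ {s} → re s ≡ ½ → im (s ⊗ (s ⊖ fromℚ 1ℚ)) ≡ 0ℚ
  re≡½⇒im[s⊗[s⊖1]]≡0 {s} u≡½ =
    trans (factor (re s) (im s)) (trans (cong (λ u → im s ℚ.* (u ℚ.+ u ℚ.- 1ℚ)) u≡½) (ℚP.*-zeroʳ (im s)))
    where
    factor : ∀ u w → u ℚ.* (w ℚ.- 0ℚ) ℚ.+ w ℚ.* (u ℚ.- 1ℚ) ≡ w ℚ.* (u ℚ.+ u ℚ.- 1ℚ)
    factor = RingSolver.solve-∀ ℚ-ring

  re≡½⇒re[s⊗[s⊖1]] : ∀ {s} e → re s ≡ ½ →
    re (s ⊗ (s ⊖ fromℚ 1ℚ)) ℚ.* (ι (+ 16) ℚ.* (d ℚ.* (e ℚ.* e)))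
      ≡ ι (ℤ.- + 4) ℚ.* (d ℚ.* (e ℚ.* e)) ℚ.+ (d ℚ.* (im s ℚ.* (ι (+ 4) ℚ.* e))) ℚ.* (d ℚ.* (im s ℚ.* (ι (+ 4) ℚ.* e)))
  re≡½⇒re[s⊗[s⊖1]] {s} e u≡½ = begin
    re (s ⊗ (s ⊖ fromℚ 1ℚ)) ℚ.* (ι (+ 16) ℚ.* (d ℚ.* (e ℚ.* e)))
      ≡⟨ expand (re s) (im s) d e ⟩
    re s ℚ.* (re s ℚ.- 1ℚ) ℚ.* ι (+ 16) ℚ.* (d ℚ.* (e ℚ.* e)) ℚ.+ y ℚ.* y
      ≡⟨ cong (λ u → u ℚ.* (u ℚ.- 1ℚ) ℚ.* ι (+ 16) ℚ.* (d ℚ.* (e ℚ.* e)) ℚ.+ y ℚ.* y) u≡½ ⟩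
    ½ ℚ.* (½ ℚ.- 1ℚ) ℚ.* ι (+ 16) ℚ.* (d ℚ.* (e ℚ.* e)) ℚ.+ y ℚ.* y
      ≡⟨⟩
    ι (ℤ.- + 4) ℚ.* (d ℚ.* (e ℚ.* e)) ℚ.+ y ℚ.* y ∎
    where
    open ≡-Reasoning
    y = d ℚ.* (im s ℚ.* (ι (+ 4) ℚ.* e))
    expand : ∀ u w d e →
      (u ℚ.* (u ℚ.- 1ℚ) ℚ.+ d ℚ.* (w ℚ.* (w ℚ.- 0ℚ))) ℚ.* (ι (+ 16) ℚ.* (d ℚ.* (e ℚ.* e)))
        ≡ u ℚ.* (u ℚ.- 1ℚ) ℚ.* ι (+ 16) ℚ.* (d ℚ.* (e ℚ.* e)) ℚ.+
          (d ℚ.* (w ℚ.* (ι (+ 4) ℚ.* e))) ℚ.* (d ℚ.* (w ℚ.* (ι (+ 4) ℚ.* e)))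
    expand = RingSolver.solve-∀ ℚ-ring

  re≡½⇒re[2⊖4⊗s]≡0 : ∀ {s} → re s ≡ ½ → re (fromℚ (ι (+ 2)) ⊖ (fromℚ (ι (+ 4)) ⊗ s)) ≡ 0ℚ
  re≡½⇒re[2⊖4⊗s]≡0 {s} u≡½ = trans (simplify (re s) (im s) d) (cong (λ u → ι (+ 2) ℚ.- ι (+ 4) ℚ.* u) u≡½)
    where
    simplify : ∀ u w d → ι (+ 2) ℚ.- (ι (+ 4) ℚ.* u ℚ.+ d ℚ.* (0ℚ ℚ.* w)) ≡ ι (+ 2) ℚ.- ι (+ 4) ℚ.* u
    simplify = RingSolver.solve-∀ ℚ-ring

  Val-z₀ : ∀ q → vℚ q d ≡ + 0 → Val q z₀ 0ℚ
  Val-z₀ q vd≡0 = inj₂ (refl , (λ ()) ,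
    sym (cong₂ (λ i j → ι i ℚ.+ ½ ℚ.* ι j) (ℤP.+-inverseʳ (+ vℕ q 1)) vd≡0))

  re≡0⇒Val-integral : ∀ q {x} → re x ≡ 0ℚ → vℚ q d ≡ + 0 → x ≡ fromℚ 0ℚ ⊎ Σ ℚ (λ k → Val q x k × IsInt k)
  re≡0⇒Val-integral q {x} re≡0 vd≡0 with im x ℚP.≟ 0ℚ
  ... | yes im≡0 = inj₁ (cong₂ _+_z₀ re≡0 im≡0)
  ... | no im≢0  = inj₂ (ι (vℚ q (im x)) ℚ.+ ½ ℚ.* ι (vℚ q d) , inj₂ (re≡0 , im≢0 , refl) ,
                         vℚ q (im x) , trans (cong (λ j → ι (vℚ q (im x)) ℚ.+ ½ ℚ.* ι j) vd≡0) (ℚP.+-identityʳ _))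

[-ABab]^r≡-[AB]^2k*Aaʳ*Bbʳ : ∀ A B a b {k r} → r ≡ suc (2 ℕ.* k) →
  (ℤ.- (A ℤ.* B ℤ.* a ℤ.* b)) ℤ.^ r ≡ ℤ.- ((A ℤ.* B) ℤ.^ k ℤ.* (A ℤ.* B) ℤ.^ k ℤ.* (A ℤ.* a ℤ.^ r) ℤ.* (B ℤ.* b ℤ.^ r))
[-ABab]^r≡-[AB]^2k*Aaʳ*Bbʳ A B a b {k} refl = begin
  E ℤ.^ suc (2 ℕ.* k)                                 ≡⟨ i^[2k+1] E k ⟩
  E ℤ.* (E ℤ.^ k ℤ.* E ℤ.^ k)                         ≡⟨ cong (E ℤ.*_) (^-distribʳ-* E E k) ⟨
  E ℤ.* (E ℤ.* E) ℤ.^ k                               ≡⟨ cong (λ y → E ℤ.* y ℤ.^ k) (square A B a b) ⟩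
  E ℤ.* (ABab ℤ.* ABab) ℤ.^ k                         ≡⟨ cong (E ℤ.*_) (^-distribʳ-* ABab ABab k) ⟩
  E ℤ.* (ABab ℤ.^ k ℤ.* ABab ℤ.^ k)                   ≡⟨ cong (λ y → E ℤ.* (y ℤ.* y)) ABabᵏ≡ ⟩
  E ℤ.* (P ℤ.* (α ℤ.* β) ℤ.* (P ℤ.* (α ℤ.* β)))       ≡⟨ regroup A B a b P α β ⟩
  ℤ.- (P ℤ.* P ℤ.* (A ℤ.* (a ℤ.* (α ℤ.* α))) ℤ.* (B ℤ.* (b ℤ.* (β ℤ.* β))))
    ≡⟨ cong₂ (λ y z → ℤ.- (P ℤ.* P ℤ.* (A ℤ.* y) ℤ.* (B ℤ.* z))) (i^[2k+1] a k) (i^[2k+1] b k) ⟨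
  ℤ.- (P ℤ.* P ℤ.* (A ℤ.* a ℤ.^ suc (2 ℕ.* k)) ℤ.* (B ℤ.* b ℤ.^ suc (2 ℕ.* k))) ∎
  where
  open ≡-Reasoning
  E = ℤ.- (A ℤ.* B ℤ.* a ℤ.* b)
  ABab = A ℤ.* B ℤ.* (a ℤ.* b)
  P = (A ℤ.* B) ℤ.^ k
  α = a ℤ.^ k
  β = b ℤ.^ k
  square : ∀ A B a b → ℤ.- (A ℤ.* B ℤ.* a ℤ.* b) ℤ.* ℤ.- (A ℤ.* B ℤ.* a ℤ.* b)
                       ≡ A ℤ.* B ℤ.* (a ℤ.* b) ℤ.* (A ℤ.* B ℤ.* (a ℤ.* b))
  square = ℤ-solve-∀
  ABabᵏ≡ : ABab ℤ.^ k ≡ P ℤ.* (α ℤ.* β)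
  ABabᵏ≡ = trans (^-distribʳ-* (A ℤ.* B) (a ℤ.* b) k) (cong (P ℤ.*_) (^-distribʳ-* a b k))
  regroup : ∀ A B a b P α β → ℤ.- (A ℤ.* B ℤ.* a ℤ.* b) ℤ.* (P ℤ.* (α ℤ.* β) ℤ.* (P ℤ.* (α ℤ.* β)))
                              ≡ ℤ.- (P ℤ.* P ℤ.* (A ℤ.* (a ℤ.* (α ℤ.* α))) ℤ.* (B ℤ.* (b ℤ.* (β ℤ.* β))))
  regroup = ℤ-solve-∀

module CaseB {r p : ℕ} (r-prime : Prime r) (5≤r : 5 ℕ.≤ r) (r<p : r ℕ.< p) {A B C a b c : ℤ}
             (coefficients : Coefficients r A B C) (solution : PrimitiveSolution A B C r p a b c) where

  open Coefficients coefficients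
  open PrimitiveSolution solution

  private
    E : ℤ
    E = ℤ.- (A ℤ.* B ℤ.* a ℤ.* b)

  open Quad (ι E)

  private
    k : ℕ
    k = (r ℕ.∸ 1) ℕ./ 2

    r≡2k+1 : r ≡ suc (2 ℕ.* k)
    r≡2k+1 = prime≥3⇒odd r-prime (ℕP.≤-trans (s≤s (s≤s (s≤s z≤n))) 5≤r)

    1≤k : 1 ℕ.≤ k
    1≤k with k | r≡2k+1
    ... | zero  | r≡1   = ⊥-elim (ℕP.<⇒≱ (ℕP.<-≤-trans (s≤s (s≤s z≤n)) 5≤r) (ℕP.≤-reflexive r≡1))
    ... | suc _ | _     = s≤s z≤n

    M N : ℤ
    M = (A ℤ.* B) ℤ.^ k ℤ.* (A ℤ.* a ℤ.^ r ℤ.- B ℤ.* b ℤ.^ r)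
    N = (A ℤ.* B) ℤ.^ k ℤ.* (C ℤ.* c ℤ.^ p)

    AB≢0 : A ℤ.* B ≢ + 0
    AB≢0 = i*j≢0 A≢0 B≢0
    E≢0 : E ≢ + 0
    E≢0 = -i≢0 (i*j≢0 (i*j≢0 AB≢0 a≢0) b≢0)
    Ccᵖ≢0 : C ℤ.* c ℤ.^ p ≢ + 0
    Ccᵖ≢0 = i*j≢0 C≢0 (i^n≢0 p c≢0)
    N≢0 : N ≢ + 0
    N≢0 = i*j≢0 (i^n≢0 k AB≢0) Ccᵖ≢0

    e : ℚ
    e = ι (E ℤ.^ k)

    z₀^r≡ez₀ : z₀ ^Q r ≡ 0ℚ + e z₀
    z₀^r≡ez₀ = trans (cong (z₀ ^Q_) r≡2k+1) (trans (z₀^[2j+1] (ι E) k) (cong (0ℚ +_z₀) (sym (ι-homo-^ E k))))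

    ιEʳ≡ : ι (E ℤ.^ r) ≡ ι E ℚ.* (e ℚ.* e)
    ιEʳ≡ = begin
      ι (E ℤ.^ r)                          ≡⟨ cong (λ n → ι (E ℤ.^ n)) r≡2k+1 ⟩
      ι (E ℤ.^ suc (2 ℕ.* k))              ≡⟨ cong ι (i^[2k+1] E k) ⟩
      ι (E ℤ.* (E ℤ.^ k ℤ.* E ℤ.^ k))      ≡⟨ ι-homo-* E (E ℤ.^ k ℤ.* E ℤ.^ k) ⟩
      ι E ℚ.* ι (E ℤ.^ k ℤ.* E ℤ.^ k)      ≡⟨ cong (ι E ℚ.*_) (ι-homo-* (E ℤ.^ k) (E ℤ.^ k)) ⟩
      ι E ℚ.* (e ℚ.* e)                    ∎
      where open ≡-Reasoning

    -4Eʳ+M²≡N² : ℤ.- + 4 ℤ.* E ℤ.^ r ℤ.+ M ℤ.* M ≡ N ℤ.* N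
    -4Eʳ+M²≡N² = begin
      ℤ.- + 4 ℤ.* E ℤ.^ r ℤ.+ M ℤ.* M
        ≡⟨ cong (λ y → ℤ.- + 4 ℤ.* y ℤ.+ M ℤ.* M) ([-ABab]^r≡-[AB]^2k*Aaʳ*Bbʳ A B a b {k} r≡2k+1) ⟩
      ℤ.- + 4 ℤ.* ℤ.- (Pᵏ ℤ.* Pᵏ ℤ.* U ℤ.* V) ℤ.+ (Pᵏ ℤ.* (U ℤ.- V)) ℤ.* (Pᵏ ℤ.* (U ℤ.- V))
        ≡⟨ complete-square Pᵏ U V ⟩
      (Pᵏ ℤ.* (U ℤ.+ V)) ℤ.* (Pᵏ ℤ.* (U ℤ.+ V))
        ≡⟨ cong (λ y → (Pᵏ ℤ.* y) ℤ.* (Pᵏ ℤ.* y)) equation ⟩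
      N ℤ.* N ∎
      where
      open ≡-Reasoning
      Pᵏ = (A ℤ.* B) ℤ.^ k
      U = A ℤ.* a ℤ.^ r
      V = B ℤ.* b ℤ.^ r
      complete-square : ∀ P U V → ℤ.- + 4 ℤ.* ℤ.- (P ℤ.* P ℤ.* U ℤ.* V) ℤ.+ (P ℤ.* (U ℤ.- V)) ℤ.* (P ℤ.* (U ℤ.- V))
                                  ≡ (P ℤ.* (U ℤ.+ V)) ℤ.* (P ℤ.* (U ℤ.+ V))
      complete-square = ℤ-solve-∀

  module Local (s₀ : QZ)
               (s₀-def : s₀ ⊗ (fromℚ (ι (+ 4)) ⊗ (z₀ ^Q r)) ≡ (fromℚ (ι (+ 2)) ⊗ (z₀ ^Q r)) ⊕ fromℚ (ι M))
               {q : ℕ} (q-prime : Prime q) {ν : ℚ} (ν-def : Val q (s₀ ⊗ (s₀ ⊖ fromℚ 1ℚ)) ν) where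

    private
      S : QZ
      S = s₀ ⊗ (s₀ ⊖ fromℚ 1ℚ)

      solved : re s₀ ≡ ½ × ι E ℚ.* (im s₀ ℚ.* (ι (+ 4) ℚ.* e)) ≡ ι M
      solved = s₀-from-defining-equation (ι E) {s₀} (ι≢0 (i^n≢0 k E≢0))
        (subst (λ z → s₀ ⊗ (fromℚ (ι (+ 4)) ⊗ z) ≡ (fromℚ (ι (+ 2)) ⊗ z) ⊕ fromℚ (ι M)) z₀^r≡ez₀ s₀-def)

      im-S≡0 : im S ≡ 0ℚ
      im-S≡0 = re≡½⇒im[s⊗[s⊖1]]≡0 (ι E) {s₀} (proj₁ solved)

      re-S-def : re S ℚ.* ι (+ 16 ℤ.* E ℤ.^ r) ≡ ι (N ℤ.* N)
      re-S-def = begin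
        re S ℚ.* ι (+ 16 ℤ.* E ℤ.^ r)
          ≡⟨ cong (re S ℚ.*_) (trans (ι-homo-* (+ 16) (E ℤ.^ r)) (cong (ι (+ 16) ℚ.*_) ιEʳ≡)) ⟩
        re S ℚ.* (ι (+ 16) ℚ.* (ι E ℚ.* (e ℚ.* e)))
          ≡⟨ re≡½⇒re[s⊗[s⊖1]] (ι E) {s₀} e (proj₁ solved) ⟩
        ι (ℤ.- + 4) ℚ.* (ι E ℚ.* (e ℚ.* e)) ℚ.+ y ℚ.* y
          ≡⟨ cong₂ (λ u v → ι (ℤ.- + 4) ℚ.* u ℚ.+ v ℚ.* v) (sym ιEʳ≡) (proj₂ solved) ⟩
        ι (ℤ.- + 4) ℚ.* ι (E ℤ.^ r) ℚ.+ ι M ℚ.* ι M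
          ≡⟨ cong₂ ℚ._+_ (ι-homo-* (ℤ.- + 4) (E ℤ.^ r)) (ι-homo-* M M) ⟨
        ι (ℤ.- + 4 ℤ.* E ℤ.^ r) ℚ.+ ι (M ℤ.* M)
          ≡⟨ ι-homo-+ (ℤ.- + 4 ℤ.* E ℤ.^ r) (M ℤ.* M) ⟨
        ι (ℤ.- + 4 ℤ.* E ℤ.^ r ℤ.+ M ℤ.* M)
          ≡⟨ cong ι -4Eʳ+M²≡N² ⟩
        ι (N ℤ.* N) ∎
        where
        open ≡-Reasoning
        y = ι E ℚ.* (im s₀ ℚ.* (ι (+ 4) ℚ.* e))

      t s x w P Q : ℕ
      t = vℤ q (A ℤ.* B)
      s = vℤ q E
      x = vℤ q (C ℤ.* c ℤ.^ p)
      w = vℕ q 16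
      P = 2 ℕ.* (k ℕ.* t ℕ.+ x)
      Q = w ℕ.+ r ℕ.* s

      S-rational : Val q S ν → re S ≢ 0ℚ × ν ≡ ι (vℚ q (re S))
      S-rational (inj₁ (_ , re-S≢0 , ν≡)) = re-S≢0 , ν≡
      S-rational (inj₂ (_ , im-S≢0 , _))  = ⊥-elim (im-S≢0 im-S≡0)

      ν≡ι[P-Q] : ν ≡ ι (+ P ℤ.- + Q)
      ν≡ι[P-Q] = trans (proj₂ (S-rational ν-def)) (cong ι (begin
        vℚ q (re S)
          ≡⟨ *ι≡ι⇒vℚ≡ q-prime (re S) 16Eʳ≢0 (i*j≢0 N≢0 N≢0) re-S-def ⟩
        + vℤ q (N ℤ.* N) ℤ.- + vℤ q (+ 16 ℤ.* E ℤ.^ r)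
          ≡⟨ cong₂ (λ m n → + m ℤ.- + n) vNN v16Eʳ ⟩
        + P ℤ.- + Q ∎))
        where
        open ≡-Reasoning
        16Eʳ≢0 : + 16 ℤ.* E ℤ.^ r ≢ + 0
        16Eʳ≢0 = i*j≢0 {+ 16} (λ ()) (i^n≢0 r E≢0)
        vN : vℤ q N ≡ k ℕ.* t ℕ.+ x
        vN = trans (vℤ-* q-prime (i^n≢0 k AB≢0) Ccᵖ≢0) (cong (ℕ._+ x) (vℤ-^ q-prime k AB≢0))
        vNN : vℤ q (N ℤ.* N) ≡ P
        vNN = trans (vℤ-* q-prime N≢0 N≢0)
                (trans (cong (λ v → v ℕ.+ v) vN) (cong (k ℕ.* t ℕ.+ x ℕ.+_) (sym (ℕP.+-identityʳ (k ℕ.* t ℕ.+ x)))))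
        v16Eʳ : vℤ q (+ 16 ℤ.* E ℤ.^ r) ≡ Q
        v16Eʳ = trans (vℤ-* q-prime {+ 16} (λ ()) (i^n≢0 r E≢0)) (cong (w ℕ.+_) (vℤ-^ q-prime r E≢0))

      ι⁻¹ν : ∀ {i} → ν ≡ ι i → + P ℤ.- + Q ≡ i
      ι⁻¹ν ν≡ιi = ι-injective (trans (sym ν≡ι[P-Q]) ν≡ιi)

      t≤s : t ℕ.≤ s
      t≤s = begin
        vℤ q (A ℤ.* B)                                  ≤⟨ ℕP.m≤m+n _ _ ⟩
        vℤ q (A ℤ.* B) ℕ.+ vℤ q a                       ≤⟨ ℕP.m≤m+n _ _ ⟩
        vℤ q (A ℤ.* B) ℕ.+ vℤ q a ℕ.+ vℤ q b            ≡⟨ cong (ℕ._+ vℤ q b) (vℤ-* q-prime AB≢0 a≢0) ⟨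
        vℤ q (A ℤ.* B ℤ.* a) ℕ.+ vℤ q b                 ≡⟨ vℤ-* q-prime (i*j≢0 AB≢0 a≢0) b≢0 ⟨
        vℤ q (A ℤ.* B ℤ.* a ℤ.* b)                      ≡⟨ vℤ-neg q (A ℤ.* B ℤ.* a ℤ.* b) ⟨
        vℤ q E                                          ∎
        where open ℕP.≤-Reasoning

      t<r : t ℕ.< r
      t<r with q ℕD.∣? ℤ.∣ A ∣
      ... | no q∤A  = subst (ℕ._< r) (sym vAB≡vB) (q^r∤⇒vℕ<r q-prime (B≢0 ∘ ℤP.∣i∣≡0⇒i≡0) (B-free q q-prime))
        where
        vAB≡vB : t ≡ vℤ q B
        vAB≡vB = trans (vℤ-* q-prime A≢0 B≢0) (cong (ℕ._+ vℤ q B) (q∤⇒vℤ≡0 q-prime A q∤A))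
      ... | yes q∣A = subst (ℕ._< r) (sym vAB≡vA) (q^r∤⇒vℕ<r q-prime (A≢0 ∘ ℤP.∣i∣≡0⇒i≡0) (A-free q q-prime))
        where
        q∤B : ¬ + q ℤD.∣ B
        q∤B q∣B = prime∣m∣n⇒¬coprime q-prime q∣A q∣B coprime-AB
        vAB≡vA : t ≡ vℤ q A
        vAB≡vA = trans (vℤ-* q-prime A≢0 B≢0) (trans (cong (vℤ q A ℕ.+_) (q∤⇒vℤ≡0 q-prime B q∤B)) (ℕP.+-identityʳ _))

      separated : x ≡ 0 ⊎ s ≡ 0
      separated with separation q-prime (ℕP.≤-trans (s≤s z≤n) 5≤r) ℕP.≤-refl (ℕP.<⇒≤ r<p) coefficients solution
      ... | inj₁ (q∤C , q∤c)             = inj₁ (q∤K,k⇒vℤ[K*kⁿ]≡0 q-prime p C≢0 c≢0 q∤C q∤c)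
      ... | inj₂ (q∤A , q∤B , q∤a , q∤b) = inj₂ (trans (vℤ-neg q (A ℤ.* B ℤ.* a ℤ.* b))
                                                  (q∤⇒vℤ≡0 q-prime (A ℤ.* B ℤ.* a ℤ.* b) q∤ABab))
        where
        q∤ABab : ¬ + q ℤD.∣ A ℤ.* B ℤ.* a ℤ.* b
        q∤ABab = q∤i,j⇒q∤i*j q-prime {A ℤ.* B ℤ.* a} {b}
                   (q∤i,j⇒q∤i*j q-prime {A ℤ.* B} {a} (q∤i,j⇒q∤i*j q-prime {A} {B} q∤A q∤B) q∤a) q∤b

      ν≥0⇒vd≡0 : 0ℚ ℚ.≤ ν → vℚ q (ι E) ≡ + 0
      ν≥0⇒vd≡0 0≤ν = trans (vℚ-ι q-prime E≢0) (cong +_ (case-b-ν≥0 {r} {k} {t} {s} {x} {w} r≡2k+1 t≤s separated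
        (0≤ι[m-n]⇒n≤m (subst (0ℚ ℚ.≤_) ν≡ι[P-Q] 0≤ν))))

    ν≥0⇒vz₀≡0 : 0ℚ ℚ.≤ ν → Val q z₀ 0ℚ
    ν≥0⇒vz₀≡0 = Val-z₀ (ι E) q ∘ ν≥0⇒vd≡0

    ν≥0⇒v[2-4s₀]∈ℤ : 0ℚ ℚ.≤ ν →
      (fromℚ (ι (+ 2)) ⊖ (fromℚ (ι (+ 4)) ⊗ s₀) ≡ fromℚ 0ℚ) ⊎
      Σ ℚ (λ v → Val q (fromℚ (ι (+ 2)) ⊖ (fromℚ (ι (+ 4)) ⊗ s₀)) v × IsInt v)
    ν≥0⇒v[2-4s₀]∈ℤ = re≡0⇒Val-integral (ι E) q (re≡½⇒re[2⊖4⊗s]≡0 (ι E) {s₀} (proj₁ solved)) ∘ ν≥0⇒vd≡0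

    ν≤0⇒v[δ²ʳS]≡0 : 3 ℕ.≤ q → ν ℚ.≤ 0ℚ → Σ ℤ (λ i → ν ≡ ι (i ℤ.* + r)) → Val q ((z₀ ^Q (2 ℕ.* r)) ⊗ S) 0ℚ
    ν≤0⇒v[δ²ʳS]≡0 3≤q ν≤0 (i , ν≡ir) =
      subst (λ y → Val q y 0ℚ) (sym z₀²ʳS≡) (inj₁ (refl , p*q≢0 dʳ≢0 re-S≢0 , sym (cong ι total)))
      where
      open ≡-Reasoning
      re-S≢0 : re S ≢ 0ℚ
      re-S≢0 = proj₁ (S-rational ν-def)
      dʳ≢0 : ι E ^ℚ r ≢ 0ℚ
      dʳ≢0 = subst (_≢ 0ℚ) (ι-homo-^ E r) (ι≢0 (i^n≢0 r E≢0))
      z₀²ʳS≡ : (z₀ ^Q (2 ℕ.* r)) ⊗ S ≡ (ι E ^ℚ r ℚ.* re S) + 0ℚ z₀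
      z₀²ʳS≡ = trans (cong₂ _⊗_ (z₀^[2j] (ι E) r) (cong (re S +_z₀) im-S≡0))
                     (fromℚ-⊗-rational (ι E) (ι E ^ℚ r) (re S))
      w≡0 : w ≡ 0
      w≡0 = q∤⇒vℕ≡0 q-prime (λ q∣16 →
              [ q∤1 q-prime , (λ q∣2 → ℕP.<⇒≱ 3≤q (ℕD.∣⇒≤ q∣2)) ]′ (prime∣m*n^k⇒∣m⊎∣n 4 q-prime q∣16))
      Q≡rs : Q ≡ r ℕ.* s
      Q≡rs = cong (ℕ._+ r ℕ.* s) w≡0
      P≡0 : P ≡ 0
      P≡0 = case-b-ν≤0 i r≡2k+1 r-prime 1≤k t<r separated
              (subst (P ℕ.≤_) Q≡rs (ι[m-n]≤0⇒m≤n (subst (ℚ._≤ 0ℚ) ν≡ι[P-Q] ν≤0)))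
              (subst (λ n → + P ℤ.- + n ≡ i ℤ.* + r) Q≡rs (ι⁻¹ν ν≡ir))
      total : vℚ q (ι E ^ℚ r ℚ.* re S) ≡ + 0
      total = begin
        vℚ q (ι E ^ℚ r ℚ.* re S)
          ≡⟨ vℚ-* q-prime dʳ≢0 re-S≢0 ⟩
        vℚ q (ι E ^ℚ r) ℤ.+ vℚ q (re S)
          ≡⟨ cong₂ ℤ._+_ vdʳ (sym (ι⁻¹ν (proj₂ (S-rational ν-def)))) ⟩
        + (r ℕ.* s) ℤ.+ (+ P ℤ.- + Q)
          ≡⟨ t+m≡n⇒t+[m-n]≡0 (trans (cong (r ℕ.* s ℕ.+_) P≡0) (trans (ℕP.+-identityʳ _) (sym Q≡rs))) ⟩
        + 0 ∎
        where
        vdʳ : vℚ q (ι E ^ℚ r) ≡ + (r ℕ.* s)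
        vdʳ = trans (cong (vℚ q) (sym (ι-homo-^ E r)))
                (trans (vℚ-ι q-prime (i^n≢0 r E≢0)) (cong +_ (vℤ-^ q-prime r E≢0)))

    ν≢-1,-3 : q ≡ 2 → ∀ j → j ℕ.≤ 1 → ν ≢ ι (ℤ.- + suc (2 ℕ.* j))
    ν≢-1,-3 q≡2 j j≤1 ν≡ = case-b-ν≢-1,-3 {r} {k} {t} {s} {x} j r≡2k+1 j≤1 t≤s separated
      (trans (sym Q≡4+rs) (m-n≡-k⇒n≡m+k (ι⁻¹ν ν≡)))
      where
      Q≡4+rs : Q ≡ 4 ℕ.+ r ℕ.* s
      Q≡4+rs = cong (ℕ._+ r ℕ.* s) (subst (λ q → vℕ q 16 ≡ 4) (sym q≡2) refl)

lemma3p32 :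
  (r p : ℕ) → Prime r → Prime p → 5 ℕ.≤ r → r ℕ.< p →
  (A B C : ℤ) → A ≢ + 0 → B ≢ + 0 → C ≢ + 0 →
  Coprime ℤ.∣ A ∣ ℤ.∣ B ∣ → Coprime ℤ.∣ A ∣ ℤ.∣ C ∣ → Coprime ℤ.∣ B ∣ ℤ.∣ C ∣ →
  (∀ ℓ → Prime ℓ → ¬ (ℓ ℕ.^ r ∣ ℤ.∣ A ∣)) →
  (∀ ℓ → Prime ℓ → ¬ (ℓ ℕ.^ r ∣ ℤ.∣ B ∣)) →
  (∀ ℓ → Prime ℓ → ¬ (ℓ ℕ.^ r ∣ ℤ.∣ C ∣)) →
  -- case (a)
  ((a b c : ℤ) → a ℤ.* b ℤ.* c ≢ + 0 →
    (∀ e → e ∣ ℤ.∣ a ∣ → e ∣ ℤ.∣ b ∣ → e ∣ ℤ.∣ c ∣ → e ≡ 1) →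
    A ℤ.* a ℤ.^ p ℤ.+ B ℤ.* b ℤ.^ p ≡ C ℤ.* c ℤ.^ r →
    (s₀ : ℚ) → s₀ ℚ.* ι (C ℤ.* c ℤ.^ r) ≡ ι (A ℤ.* a ℤ.^ p) →
    let δ = ι (C ℤ.* c) in
    (q : ℕ) → Prime q → (ν : ℚ) → ValQ q (s₀ ℚ.* (s₀ ℚ.- 1ℚ)) ν →
      (0ℚ ℚ.≤ ν →
        ValQ q δ 0ℚ ×
        ((ι (+ 2) ℚ.- ι (+ 4) ℚ.* s₀ ≡ 0ℚ) ⊎
         Σ ℚ (λ k → ValQ q (ι (+ 2) ℚ.- ι (+ 4) ℚ.* s₀) k × IsInt k))) ×
      (3 ℕ.≤ q → ν ℚ.≤ 0ℚ → Σ ℤ (λ m → ν ≡ ι (m ℤ.* + r)) →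
        ValQ q (δ ^ℚ (2 ℕ.* r) ℚ.* (s₀ ℚ.* (s₀ ℚ.- 1ℚ))) 0ℚ) ×
      (q ≡ 2 → ν ℚ.≤ 0ℚ → (ν ≢ ι (ℤ.- + 3)) × (ν ≢ ι (ℤ.- + 1)))) ×
  -- case (b)
  ((a b c : ℤ) → a ℤ.* b ℤ.* c ≢ + 0 →
    (∀ e → e ∣ ℤ.∣ a ∣ → e ∣ ℤ.∣ b ∣ → e ∣ ℤ.∣ c ∣ → e ≡ 1) →
    A ℤ.* a ℤ.^ r ℤ.+ B ℤ.* b ℤ.^ r ≡ C ℤ.* c ℤ.^ p →
    let open Quad (ι (ℤ.- (A ℤ.* B ℤ.* a ℤ.* b))) in
    (s₀ : QZ) →
    s₀ ⊗ (fromℚ (ι (+ 4)) ⊗ (z₀ ^Q r)) ≡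
      (fromℚ (ι (+ 2)) ⊗ (z₀ ^Q r)) ⊕
      fromℚ (ι ((A ℤ.* B) ℤ.^ ((r ℕ.∸ 1) ℕ./ 2) ℤ.* (A ℤ.* a ℤ.^ r ℤ.- B ℤ.* b ℤ.^ r))) →
    let δ = z₀ in
    (q : ℕ) → Prime q → (ν : ℚ) → Val q (s₀ ⊗ (s₀ ⊖ fromℚ 1ℚ)) ν →
      (0ℚ ℚ.≤ ν →
        Val q δ 0ℚ ×
        ((fromℚ (ι (+ 2)) ⊖ (fromℚ (ι (+ 4)) ⊗ s₀) ≡ fromℚ 0ℚ) ⊎
         Σ ℚ (λ k → Val q (fromℚ (ι (+ 2)) ⊖ (fromℚ (ι (+ 4)) ⊗ s₀)) k × IsInt k))) ×
      (3 ℕ.≤ q → ν ℚ.≤ 0ℚ → Σ ℤ (λ m → ν ≡ ι (m ℤ.* + r)) →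
        Val q ((δ ^Q (2 ℕ.* r)) ⊗ (s₀ ⊗ (s₀ ⊖ fromℚ 1ℚ))) 0ℚ) ×
      (q ≡ 2 → ν ℚ.≤ 0ℚ → (ν ≢ ι (ℤ.- + 3)) × (ν ≢ ι (ℤ.- + 1))))
-- Neither the primality of p nor, in case (a), the bound q ≥ 3 is needed, and (H3) holds without ν ≤ 0.
lemma3p32 r p r-prime _ 5≤r r<p A B C A≢0 B≢0 C≢0 coprime-AB coprime-AC coprime-BC A-free B-free C-free =
  (λ a b c abc≢0 coprime-abc equation s₀ s₀-def q q-prime ν ν-def →
    let open CaseA r-prime 5≤r r<p coefficients (solution abc≢0 coprime-abc equation) s₀ s₀-def q-prime ν-def
    in (λ 0≤ν → ν≥0⇒vδ≡0 0≤ν , vℚ-integral q _) , (λ _ → ν≤0⇒v[δ²ʳS]≡0) , (λ _ _ → ν≢-odd 1 , ν≢-odd 0)) ,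
  (λ a b c abc≢0 coprime-abc equation s₀ s₀-def q q-prime ν ν-def →
    let open CaseB r-prime 5≤r r<p coefficients (solution abc≢0 coprime-abc equation)
        open Local s₀ s₀-def q-prime ν-def
    in (λ 0≤ν → ν≥0⇒vz₀≡0 0≤ν , ν≥0⇒v[2-4s₀]∈ℤ 0≤ν) , ν≤0⇒v[δ²ʳS]≡0 ,
       (λ q≡2 _ → ν≢-1,-3 q≡2 1 ℕP.≤-refl , ν≢-1,-3 q≡2 0 z≤n))
  where
  coefficients : Coefficients r A B C
  coefficients = record
    { A≢0 = A≢0 ; B≢0 = B≢0 ; C≢0 = C≢0
    ; coprime-AB = coprime-AB ; coprime-AC = coprime-AC ; coprime-BC = coprime-BC
    ; A-free = A-free ; B-free = B-free ; C-free = C-free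
    }
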